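{- Let $a,b,M$ be positive integers with $M\mid ab$. Then there is an integer $E=E(a,b,M)>0$ such that for all $\ell\mid M$ with $\varepsilon_\ell(a^b)\neq0$, \[ (-1)^{\frac{ab}{\ell}(\ell-1)}\,\varepsilon_\ell(a^b)=\xi^{E}, \] where $\xi$ is a primitive $\ell$-th root of unity.
   Context: $a^b$ denotes the rectangular Young diagram with $b$ rows of length $a$. An $\ell$-ribbon is a connected skew shape with $\ell$ boxes containing no $2\times2$ square. For an $\ell$-ribbon $R$, $\varepsilon_\ell(R)=(-1)^{h-1}$ where $h$ is the number of rows $R$ occupies. For a skew shape $\lambda/\mu$, $\varepsilon_\ell(\lambda/\mu)=\prod_j\varepsilon_\ell(R_j)$ for any decomposition of $\lambda/\mu$ into $\ell$-ribbons $R_1,R_2,\dots$ obtained by successively removing ribbons so that each intermediate region is a skew shape (this sign is known to be independent of the choice), and $\varepsilon_\ell(\lambda/\mu)=0$ if no such decomposition exists. -}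

module Defs where

open import Level using (0ℓ)
open import Data.Nat using (ℕ; zero; suc; _∸_; _≤_; _<_; _<?_)
open import Data.List using (List; []; _∷_; replicate; length; map; upTo; filter)
open import Data.Nat.ListAction using (sum)
open import Data.Product using (_×_; ∃-syntax)
open import Data.Sum using (_⊎_)
open import Relation.Nullary using (¬_)
open import Relation.Binary.PropositionalEquality using (_≡_)
open import Algebra.Bundles using (CommutativeRing)

-- Young diagrams.  A diagram is given by its list of row lengths;
-- rows beyond the end of the list have length 0.

row : List ℕ → ℕ → ℕ
row []       _       = 0
row (x ∷ _)  zero    = x
row (_ ∷ xs) (suc i) = row xs i

IsPartition : List ℕ → Set
IsPartition ν = ∀ i → row ν (suc i) ≤ row ν i

rect : ℕ → ℕ → List ℕ
rect a b = replicate b a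

_⊆ᵈ_ : List ℕ → List ℕ → Set
ν ⊆ᵈ λ′ = ∀ i → row ν i ≤ row λ′ i

-- cell (i , j) (row i, column j, 0-based) lies in the skew shape λ/ν
InSkew : List ℕ → List ℕ → ℕ → ℕ → Set
InSkew λ′ ν i j = row ν i ≤ j × j < row λ′ i

skewSize : List ℕ → List ℕ → ℕ
skewSize λ′ ν = sum (map (λ i → row λ′ i ∸ row ν i) (upTo (length λ′)))

skewRows : List ℕ → List ℕ → ℕ
skewRows λ′ ν = length (filter (λ i → row ν i <? row λ′ i) (upTo (length λ′)))

Adjacent : ℕ → ℕ → ℕ → ℕ → Set
Adjacent i j i′ j′ =
  ((i ≡ i′) × (suc j ≡ j′)) ⊎ ((i ≡ i′) × (j ≡ suc j′))
  ⊎ ((suc i ≡ i′) × (j ≡ j′)) ⊎ ((i ≡ suc i′) × (j ≡ j′))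

data SkewPath (λ′ ν : List ℕ) : ℕ → ℕ → ℕ → ℕ → Set where
  here : ∀ {i j} → SkewPath λ′ ν i j i j
  step : ∀ {i j i′ j′ i″ j″} → Adjacent i j i′ j′ → InSkew λ′ ν i′ j′ →
         SkewPath λ′ ν i′ j′ i″ j″ → SkewPath λ′ ν i j i″ j″

Connected : List ℕ → List ℕ → Set
Connected λ′ ν = ∀ i j i′ j′ → InSkew λ′ ν i j → InSkew λ′ ν i′ j′ →
                 SkewPath λ′ ν i j i′ j′

No2×2 : List ℕ → List ℕ → Set
No2×2 λ′ ν = ¬ (∃[ i ] ∃[ j ] (InSkew λ′ ν i j × InSkew λ′ ν i (suc j)
                             × InSkew λ′ ν (suc i) j × InSkew λ′ ν (suc i) (suc j)))

IsRibbon : ℕ → List ℕ → List ℕ → Set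
IsRibbon ℓ λ′ ν = ν ⊆ᵈ λ′ × skewSize λ′ ν ≡ ℓ × Connected λ′ ν × No2×2 λ′ ν

IsEmptyDiagram : List ℕ → Set
IsEmptyDiagram λ′ = ∀ i → row λ′ i ≡ 0

data RibbonDecomp (ℓ : ℕ) : List ℕ → Set where
  done   : ∀ {λ′} → IsEmptyDiagram λ′ → RibbonDecomp ℓ λ′
  remove : ∀ {λ′} (ν : List ℕ) → IsPartition ν → IsRibbon ℓ λ′ ν →
           RibbonDecomp ℓ ν → RibbonDecomp ℓ λ′

module _ (R : CommutativeRing 0ℓ 0ℓ) where
  open CommutativeRing R using (Carrier; _≈_; _≉_; _*_; -_; 0#; 1#)

  pow : Carrier → ℕ → Carrier
  pow x zero    = 1#
  pow x (suc n) = x * pow x n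

  negOnePow : ℕ → Carrier
  negOnePow n = pow (- 1#) n

  -- ε_ℓ of a decomposition: product over the ribbons of (-1)^(h-1)
  decompSign : ∀ {ℓ λ′} → RibbonDecomp ℓ λ′ → Carrier
  decompSign (done _) = 1#
  decompSign {λ′ = λ′} (remove ν _ _ d) = negOnePow (skewRows λ′ ν ∸ 1) * decompSign d

  IsIntegralDomain : Set
  IsIntegralDomain = (1# ≉ 0#) × (∀ x y → x * y ≈ 0# → (x ≈ 0#) ⊎ (y ≈ 0#))

  IsPrimitiveRoot : ℕ → Carrier → Set
  IsPrimitiveRoot ℓ ξ = pow ξ ℓ ≈ 1# × (∀ k → 0 < k → k < ℓ → pow ξ k ≉ 1#)

module Submission where

-- Proof via beta-numbers (James' abacus): a partition λ with at most b rows
-- is encoded by the beads β(λ) = (λ₀ + b, λ₁ + b − 1, …, λ_{b−1} + 1).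
--  1. Removing an ℓ-ribbon with h rows moves one bead down by ℓ past exactly
--     h − 1 beads (RibbonShape, ribbonMove).
--  2. Sign: reducing the beads mod ℓ, such a move changes the parity of the
--     inversion count by h − 1, so ε_ℓ(D) = (−1)^(legLength D) where the parity
--     of legLength D is inv(β λ mod ℓ) + inv(β ∅ mod ℓ) (legLength-parity).
--     For a^b it is even if ℓ ∣ a and that of q(ℓ − 1) if ℓ ∣ b (rectangle-legs-∣a/∣b).
--  3. Root sums: Σ ξ^{βᵢ} is invariant, so ξᵃ(ξ + … + ξᵇ) = ξ + … + ξᵇ, and in an
--     integral domain ℓ ∣ a or ℓ ∣ b (rectangle-dichotomy).
--  4. With E = b·(ab/2) for ab even and E = ab for ab odd, ξ^E = (−1)^{q(ℓ−1)}
--     if ℓ ∣ a and ξ^E = 1 if ℓ ∣ b (ExponentValue); the theorem follows.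

open import Defs
open import Level using (0ℓ)
open import Data.Nat
  using (ℕ; zero; suc; _+_; _*_; _∸_; _≤_; _<_; z≤n; s≤s; _<?_; _≤?_; _≟_; parity; ⌊_/2⌋; >-nonZero)
open import Data.Nat.Properties
open import Data.Nat.Divisibility using (_∣_; divides; ∣m+n∣m⇒∣n; ∣⇒≤; n∣m*n; m%n≡0⇒n∣m; 0∣⇒≡0)
open import Data.Nat.DivMod
  using (_%_; _/_; m≡m%n+[m/n]*n; [m+n]%n≡m%n; n%n≡0; m<n⇒m%n≡m; m%n<n; %-remove-+ˡ; %-remove-+ʳ)
open import Data.Nat.ListAction using (sum)
open import Data.Nat.Solver using (module +-*-Solver)
open import Data.Parity.Base as ℙ using (Parity; 0ℙ; 1ℙ)
import Data.Parity.Properties as ℙ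
open import Data.List using (List; []; _∷_; _++_; length; map; applyUpTo; filter)
open import Data.List.Properties using (map-++; length-map; ++-identityʳ)
open import Data.List.Relation.Unary.All as All using (All; []; _∷_)
import Data.List.Relation.Unary.All.Properties as AllP
open import Data.Product using (_×_; _,_; ∃-syntax; proj₁; proj₂)
open import Data.Sum using (_⊎_; inj₁; inj₂)
open import Data.Empty using (⊥-elim)
open import Function using (_∘_)
open import Relation.Nullary using (¬_; Dec; yes; no)
open import Relation.Unary using (Decidable)
open import Relation.Binary.PropositionalEquality
  using (_≡_; refl; sym; trans; cong; cong₂; subst; module ≡-Reasoning)
open import Algebra.Bundles using (CommutativeRing)
open +-*-Solver using (solve; _:=_; _:+_; _:*_; con)

betas : ℕ → (ℕ → ℕ) → List ℕ
betas zero    f = []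
betas (suc n) f = f 0 + suc n ∷ betas n (λ i → f (suc i))

topBetas : ℕ → ℕ → (ℕ → ℕ) → List ℕ
topBetas zero    m f = []
topBetas (suc r) m f = f 0 + (suc r + m) ∷ topBetas r m (λ i → f (suc i))

betas-split : ∀ r m f → betas (r + m) f ≡ topBetas r m f ++ betas m (λ i → f (r + i))
betas-split zero    m f = refl
betas-split (suc r) m f = cong (f 0 + suc (r + m) ∷_) (betas-split r m (λ i → f (suc i)))

betas-cong : ∀ n f g → (∀ i → i < n → f i ≡ g i) → betas n f ≡ betas n g
betas-cong zero    f g f≡g = refl
betas-cong (suc n) f g f≡g = cong₂ _∷_ (cong (_+ suc n) (f≡g 0 (s≤s z≤n)))
  (betas-cong n _ _ (λ i i<n → f≡g (suc i) (s≤s i<n)))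

topBetas-cong : ∀ r m f g → (∀ i → i < r → f i ≡ g i) → topBetas r m f ≡ topBetas r m g
topBetas-cong zero    m f g f≡g = refl
topBetas-cong (suc r) m f g f≡g = cong₂ _∷_ (cong (_+ (suc r + m)) (f≡g 0 (s≤s z≤n)))
  (topBetas-cong r m _ _ (λ i i<r → f≡g (suc i) (s≤s i<r)))

topBetas-shift : ∀ h k (f g : ℕ → ℕ) → (∀ i → i < h → suc (g i) ≡ f (suc i)) →
  topBetas h (suc k) g ≡ topBetas h k (λ i → f (suc i))
topBetas-shift zero    k f g shifted = refl
topBetas-shift (suc h) k f g shifted = cong₂ _∷_ head
  (topBetas-shift h k (λ i → f (suc i)) (λ i → g (suc i)) (λ i i<h → shifted (suc i) (s≤s i<h)))
  where
  head : g 0 + (suc h + suc k) ≡ f 1 + (suc h + k)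
  head = begin
    g 0 + (suc h + suc k)   ≡⟨ cong (g 0 +_) (cong suc (+-suc h k)) ⟩
    g 0 + suc (suc h + k)   ≡⟨ +-suc (g 0) (suc h + k) ⟩
    suc (g 0) + (suc h + k) ≡⟨ cong (_+ (suc h + k)) (shifted 0 (s≤s z≤n)) ⟩
    f 1 + (suc h + k)       ∎
    where open ≡-Reasoning

length-betas : ∀ n f → length (betas n f) ≡ n
length-betas zero    f = refl
length-betas (suc n) f = cong suc (length-betas n (λ i → f (suc i)))

length-topBetas : ∀ h k f → length (topBetas h k f) ≡ h
length-topBetas zero    k f = refl
length-topBetas (suc h) k f = cong suc (length-topBetas h k (λ i → f (suc i)))

topBetas-≤ : ∀ h k (f : ℕ → ℕ) U → (∀ j → j < h → f j ≤ U) →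
  All (λ m → m ≤ U + (h + k)) (topBetas h k f)
topBetas-≤ zero    k f U bound = []
topBetas-≤ (suc h) k f U bound =
  +-monoˡ-≤ (suc h + k) (bound 0 (s≤s z≤n)) ∷
  All.map (λ p → ≤-trans p (+-monoʳ-≤ U (n≤1+n (h + k))))
    (topBetas-≤ h k (λ i → f (suc i)) U (λ j j<h → bound (suc j) (s≤s j<h)))

topBetas-≥ : ∀ h k (f : ℕ → ℕ) L → (∀ j → j < h → L ≤ f j) →
  All (λ m → L + suc k ≤ m) (topBetas h k f)
topBetas-≥ zero    k f L bound = []
topBetas-≥ (suc h) k f L bound =
  +-mono-≤ (bound 0 (s≤s z≤n)) (s≤s (m≤n+m k h)) ∷
  topBetas-≥ h k (λ i → f (suc i)) L (λ j j<h → bound (suc j) (s≤s j<h))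

record BeadMove (L L′ : List ℕ) (x y : ℕ) (M : List ℕ) : Set where
  constructor beadMove
  field
    before after : List ℕ
    source : L  ≡ before ++ (x ∷ M ++ after)
    target : L′ ≡ before ++ (M ++ (y ∷ after))

-- Changing rows r, …, r + h of f into g, where g (r + i) + 1 = f (r + i + 1),
-- moves the bead of row r of f past the beads of rows r + 1, …, r + h.
betas-beadMove : ∀ r h k (f g : ℕ → ℕ) →
  (∀ i → i < r → g i ≡ f i) →
  (∀ i → i < h → suc (g (r + i)) ≡ f (r + suc i)) →
  (∀ j → r + h < j → g j ≡ f j) →
  BeadMove (betas (r + (suc h + k)) f) (betas (r + (suc h + k)) g)
           (f r + (suc h + k)) (g (r + h) + suc k) (topBetas h k (λ i → f (r + suc i)))
betas-beadMove r h k f g above linked below = beadMove (topBetas r (suc h + k) f) rest source target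
  where
  M rest : List ℕ
  M    = topBetas h k (λ i → f (r + suc i))
  rest = betas k (λ i → f (r + suc (h + i)))
  source : betas (r + (suc h + k)) f ≡ topBetas r (suc h + k) f ++ (f r + (suc h + k) ∷ M ++ rest)
  source = begin
    betas (r + (suc h + k)) f
      ≡⟨ betas-split r (suc h + k) f ⟩
    topBetas r (suc h + k) f ++ betas (suc h + k) (λ i → f (r + i))
      ≡⟨ cong (topBetas r (suc h + k) f ++_) (betas-split (suc h) k (λ i → f (r + i))) ⟩
    topBetas r (suc h + k) f ++ (f (r + 0) + (suc h + k) ∷ M ++ rest)
      ≡⟨ cong (λ z → topBetas r (suc h + k) f ++ (f z + (suc h + k) ∷ M ++ rest)) (+-identityʳ r) ⟩
    topBetas r (suc h + k) f ++ (f r + (suc h + k) ∷ M ++ rest) ∎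
    where open ≡-Reasoning
  tail : betas k (λ i → g (r + (h + suc i))) ≡ rest
  tail = betas-cong k _ _ (λ i _ → trans (cong (λ z → g (r + z)) (+-suc h i))
           (below (r + suc (h + i)) (+-monoʳ-< r (s≤s (m≤m+n h i)))))
  target : betas (r + (suc h + k)) g ≡ topBetas r (suc h + k) f ++ (M ++ (g (r + h) + suc k ∷ rest))
  target = begin
    betas (r + (suc h + k)) g
      ≡⟨ cong (λ n → betas (r + n) g) (sym (+-suc h k)) ⟩
    betas (r + (h + suc k)) g
      ≡⟨ betas-split r (h + suc k) g ⟩
    topBetas r (h + suc k) g ++ betas (h + suc k) (λ i → g (r + i))
      ≡⟨ cong₂ _++_ (trans (cong (λ m → topBetas r m g) (+-suc h k)) (topBetas-cong r _ g f above))
                    (betas-split h (suc k) (λ i → g (r + i))) ⟩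
    topBetas r (suc h + k) f ++ (topBetas h (suc k) (λ i → g (r + i)) ++ betas (suc k) (λ i → g (r + (h + i))))
      ≡⟨ cong (λ z → topBetas r (suc h + k) f ++ (z ++ betas (suc k) (λ i → g (r + (h + i)))))
              (topBetas-shift h k (λ i → f (r + i)) (λ i → g (r + i)) linked) ⟩
    topBetas r (suc h + k) f ++ (M ++ (g (r + (h + 0)) + suc k ∷ betas k (λ i → g (r + (h + suc i)))))
      ≡⟨ cong₂ (λ z t → topBetas r (suc h + k) f ++ (M ++ (g (r + z) + suc k ∷ t))) (+-identityʳ h) tail ⟩
    topBetas r (suc h + k) f ++ (M ++ (g (r + h) + suc k ∷ rest)) ∎
    where open ≡-Reasoning

sumUpTo : (ℕ → ℕ) → (ℕ → ℕ) → ℕ → ℕ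
sumUpTo t u n = sum (map t (applyUpTo u n))

sumUpTo-split : ∀ t u m n → sumUpTo t u (m + n) ≡ sumUpTo t u m + sumUpTo t (λ i → u (m + i)) n
sumUpTo-split t u zero    n = refl
sumUpTo-split t u (suc m) n =
  trans (cong (t (u 0) +_) (sumUpTo-split t (λ i → u (suc i)) m n)) (sym (+-assoc (t (u 0)) _ _))

sumUpTo-zero : ∀ t u n → (∀ i → i < n → t (u i) ≡ 0) → sumUpTo t u n ≡ 0
sumUpTo-zero t u zero    vanish = refl
sumUpTo-zero t u (suc n) vanish = cong₂ _+_ (vanish 0 (s≤s z≤n))
  (sumUpTo-zero t (λ i → u (suc i)) n (λ i i<n → vanish (suc i) (s≤s i<n)))

sumUpTo-cong : ∀ t u v n → (∀ i → i < n → t (u i) ≡ t (v i)) → sumUpTo t u n ≡ sumUpTo t v n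
sumUpTo-cong t u v zero    u≡v = refl
sumUpTo-cong t u v (suc n) u≡v = cong₂ _+_ (u≡v 0 (s≤s z≤n))
  (sumUpTo-cong t (λ i → u (suc i)) (λ i → v (suc i)) n (λ i i<n → u≡v (suc i) (s≤s i<n)))

sumUpTo-window : ∀ t r h e → (∀ i → i < r → t i ≡ 0) → (∀ i → t (r + (suc h + i)) ≡ 0) →
  sumUpTo t (λ i → i) (r + (suc h + e)) ≡ sumUpTo t (r +_) (suc h)
sumUpTo-window t r h e left right = begin
  sumUpTo t (λ i → i) (r + (suc h + e))
    ≡⟨ sumUpTo-split t (λ i → i) r (suc h + e) ⟩
  sumUpTo t (λ i → i) r + sumUpTo t (r +_) (suc h + e)
    ≡⟨ cong₂ _+_ (sumUpTo-zero t (λ i → i) r left) (sumUpTo-split t (r +_) (suc h) e) ⟩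
  sumUpTo t (r +_) (suc h) + sumUpTo t (λ i → r + (suc h + i)) e
    ≡⟨ cong (sumUpTo t (r +_) (suc h) +_) (sumUpTo-zero t _ e (λ i _ → right i)) ⟩
  sumUpTo t (r +_) (suc h) + 0
    ≡⟨ +-identityʳ _ ⟩
  sumUpTo t (r +_) (suc h) ∎
  where open ≡-Reasoning

module _ {P : ℕ → Set} (P? : Decidable P) where

  countUpTo : (ℕ → ℕ) → ℕ → ℕ
  countUpTo u n = length (filter P? (applyUpTo u n))

  countUpTo-split : ∀ u m n → countUpTo u (m + n) ≡ countUpTo u m + countUpTo (λ i → u (m + i)) n
  countUpTo-split u zero    n = refl
  countUpTo-split u (suc m) n with P? (u 0)
  ... | yes _ = cong suc (countUpTo-split (λ i → u (suc i)) m n)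
  ... | no  _ = countUpTo-split (λ i → u (suc i)) m n

  countUpTo-none : ∀ u n → (∀ i → i < n → ¬ P (u i)) → countUpTo u n ≡ 0
  countUpTo-none u zero    none = refl
  countUpTo-none u (suc n) none with P? (u 0)
  ... | yes p = ⊥-elim (none 0 (s≤s z≤n) p)
  ... | no  _ = countUpTo-none (λ i → u (suc i)) n (λ i i<n → none (suc i) (s≤s i<n))

  countUpTo-all : ∀ u n → (∀ i → i < n → P (u i)) → countUpTo u n ≡ n
  countUpTo-all u zero    every = refl
  countUpTo-all u (suc n) every with P? (u 0)
  ... | yes _  = cong suc (countUpTo-all (λ i → u (suc i)) n (λ i i<n → every (suc i) (s≤s i<n)))
  ... | no  ¬p = ⊥-elim (¬p (every 0 (s≤s z≤n)))

  countUpTo-window : ∀ r h e → (∀ i → i < r → ¬ P i) → (∀ i → i < suc h → P (r + i)) →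
    (∀ i → ¬ P (r + (suc h + i))) → countUpTo (λ i → i) (r + (suc h + e)) ≡ suc h
  countUpTo-window r h e left inside right = begin
    countUpTo (λ i → i) (r + (suc h + e))
      ≡⟨ countUpTo-split (λ i → i) r (suc h + e) ⟩
    countUpTo (λ i → i) r + countUpTo (r +_) (suc h + e)
      ≡⟨ cong₂ _+_ (countUpTo-none (λ i → i) r left) (countUpTo-split (r +_) (suc h) e) ⟩
    countUpTo (r +_) (suc h) + countUpTo (λ i → r + (suc h + i)) e
      ≡⟨ cong₂ _+_ (countUpTo-all (r +_) (suc h) inside) (countUpTo-none _ e (λ i _ → right i)) ⟩
    suc h + 0
      ≡⟨ +-identityʳ _ ⟩
    suc h ∎
    where open ≡-Reasoning

  none-suc : ∀ N → (∀ i → i < N → ¬ P i) → ¬ P N → ∀ i → i < suc N → ¬ P i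
  none-suc N none ¬p i (s≤s i≤N) with m≤n⇒m<n∨m≡n i≤N
  ... | inj₁ i<N  = none i i<N
  ... | inj₂ refl = ¬p

  least : ∀ N → (∃[ i ] (i < N × P i × (∀ j → j < i → ¬ P j))) ⊎ (∀ i → i < N → ¬ P i)
  least zero = inj₂ (λ i ())
  least (suc N) with least N
  ... | inj₁ (i , i<N , p , minimal) = inj₁ (i , m≤n⇒m≤1+n i<N , p , minimal)
  ... | inj₂ none with P? N
  ...   | yes p  = inj₁ (N , ≤-refl , p , none)
  ...   | no  ¬p = inj₂ (none-suc N none ¬p)

  greatest : ∀ N → (∃[ i ] (i < N × P i × (∀ j → i < j → j < N → ¬ P j))) ⊎ (∀ i → i < N → ¬ P i)
  greatest zero = inj₂ (λ i ())
  greatest (suc N) with P? N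
  ... | yes p = inj₁ (N , ≤-refl , p , λ j N<j j<1+N → ⊥-elim (<-irrefl refl (<-≤-trans N<j (≤-pred j<1+N))))
  ... | no ¬p with greatest N
  ...   | inj₁ (i , i<N , p , maximal) = inj₁ (i , m≤n⇒m≤1+n i<N , p , maximalBelow)
    where
    maximalBelow : ∀ j → i < j → j < suc N → ¬ P j
    maximalBelow j i<j (s≤s j≤N) with m≤n⇒m<n∨m≡n j≤N
    ... | inj₁ j<N  = maximal j i<j j<N
    ... | inj₂ refl = ¬p
  ...   | inj₂ none = inj₂ (none-suc N none ¬p)

row-beyond : ∀ xs i → length xs ≤ i → row xs i ≡ 0
row-beyond []       i       _         = refl
row-beyond (x ∷ xs) (suc i) (s≤s len) = row-beyond xs i len

nonzero-row⇒<length : ∀ xs i → 0 < row xs i → i < length xs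
nonzero-row⇒<length xs i pos with i <? length xs
... | yes i<len = i<len
... | no  i≮len = ⊥-elim (<-irrefl (sym (row-beyond xs i (≮⇒≥ i≮len))) pos)

partition-antitone : ∀ ν → IsPartition ν → ∀ i j → i ≤ j → row ν j ≤ row ν i
partition-antitone ν part i j i≤j with m≤n⇒∃[o]m+o≡n i≤j
... | d , refl = descend d
  where
  descend : ∀ d → row ν (i + d) ≤ row ν i
  descend zero    = ≤-reflexive (cong (row ν) (+-identityʳ i))
  descend (suc d) = ≤-trans (≤-reflexive (cong (row ν) (+-suc i d))) (≤-trans (part (i + d)) (descend d))

Occupied : List ℕ → List ℕ → ℕ → Set
Occupied λ′ ν i = row ν i < row λ′ i

no2×2⇒overlap≤1 : ∀ λ′ ν → IsPartition λ′ → IsPartition ν → No2×2 λ′ ν →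
  ∀ K → row λ′ (suc K) ≤ suc (row ν K)
no2×2⇒overlap≤1 λ′ ν partλ partν no-square K with row λ′ (suc K) ≤? suc (row ν K)
... | yes fits = fits
... | no  long = ⊥-elim (no-square (K , row ν K , corner₀₀ , corner₀₁ , corner₁₀ , corner₁₁))
  where
  wide : suc (row ν K) < row λ′ (suc K)
  wide = ≰⇒> long
  wide′ : suc (row ν K) < row λ′ K
  wide′ = ≤-trans wide (partλ K)
  corner₀₀ : InSkew λ′ ν K (row ν K)
  corner₀₀ = ≤-refl , ≤-trans (n≤1+n _) wide′
  corner₀₁ : InSkew λ′ ν K (suc (row ν K))
  corner₀₁ = n≤1+n _ , wide′
  corner₁₀ : InSkew λ′ ν (suc K) (row ν K)
  corner₁₀ = partν K , ≤-trans (n≤1+n _) wide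
  corner₁₁ : InSkew λ′ ν (suc K) (suc (row ν K))
  corner₁₁ = ≤-trans (partν K) (n≤1+n _) , wide

path-stays-above : ∀ λ′ ν K → row λ′ (suc K) ≤ row ν K →
  ∀ {i j i′ j′} → SkewPath λ′ ν i j i′ j′ → InSkew λ′ ν i j → i ≤ K → i′ ≤ K
path-stays-above λ′ ν K blocked here _ i≤K = i≤K
path-stays-above λ′ ν K blocked {i} {j} (step adj cell path) (ν≤j , _) i≤K =
  path-stays-above λ′ ν K blocked path cell (next adj cell)
  where
  next : ∀ {i₁ j₁} → Adjacent i j i₁ j₁ → InSkew λ′ ν i₁ j₁ → i₁ ≤ K
  next (inj₁ (refl , _))                 _ = i≤K
  next (inj₂ (inj₁ (refl , _)))          _ = i≤K
  next (inj₂ (inj₂ (inj₁ (refl , refl)))) (_ , j<λ) with m≤n⇒m<n∨m≡n i≤K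
  ... | inj₁ i<K  = i<K
  ... | inj₂ refl = ⊥-elim (<-irrefl refl (<-≤-trans j<λ (≤-trans blocked ν≤j)))
  next (inj₂ (inj₂ (inj₂ (refl , refl)))) _ = ≤-trans (n≤1+n _) i≤K

connected⇒overlap : ∀ λ′ ν → Connected λ′ ν → ∀ r r′ → Occupied λ′ ν r → Occupied λ′ ν r′ →
  ∀ K → r ≤ K → K < r′ → row ν K < row λ′ (suc K)
connected⇒overlap λ′ ν conn r r′ occ occ′ K r≤K K<r′ with row λ′ (suc K) ≤? row ν K
... | no  reaches = ≰⇒> reaches
... | yes blocked = ⊥-elim (<-irrefl refl (≤-<-trans r′≤K K<r′))
  where
  r′≤K : r′ ≤ K
  r′≤K = path-stays-above λ′ ν K blocked
           (conn r (row ν r) r′ (row ν r′) (≤-refl , occ) (≤-refl , occ′)) (≤-refl , occ) r≤K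

ribbon-telescope : ∀ (f g : ℕ → ℕ) h r → (∀ i → g i ≤ f i) →
  (∀ i → i < h → suc (g (r + i)) ≡ f (r + suc i)) →
  sumUpTo (λ i → f i ∸ g i) (r +_) (suc h) + g (r + h) ≡ f r + h
ribbon-telescope f g zero r g≤f linked = begin
  ((f (r + 0) ∸ g (r + 0)) + 0) + g (r + 0) ≡⟨ cong (λ z → ((f z ∸ g z) + 0) + g z) (+-identityʳ r) ⟩
  ((f r ∸ g r) + 0) + g r                   ≡⟨ cong (_+ g r) (+-identityʳ _) ⟩
  (f r ∸ g r) + g r                         ≡⟨ m∸n+n≡m (g≤f r) ⟩
  f r                                       ≡⟨ sym (+-identityʳ _) ⟩
  f r + 0                                   ∎
  where open ≡-Reasoning
ribbon-telescope f g (suc h) r g≤f linked = begin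
  (t (r + 0) + sumUpTo t (λ i → r + suc i) (suc h)) + g (r + suc h)
    ≡⟨ cong₂ (λ s z → (t (r + 0) + s) + g z)
             (sumUpTo-cong t _ _ (suc h) (λ i _ → cong t (+-suc r i))) (+-suc r h) ⟩
  (t (r + 0) + sumUpTo t (suc r +_) (suc h)) + g (suc r + h)
    ≡⟨ +-assoc (t (r + 0)) _ _ ⟩
  t (r + 0) + (sumUpTo t (suc r +_) (suc h) + g (suc r + h))
    ≡⟨ cong (t (r + 0) +_) (ribbon-telescope f g h (suc r) g≤f linked′) ⟩
  t (r + 0) + (f (suc r) + h)
    ≡⟨ cong (λ z → t (r + 0) + (z + h)) (sym first) ⟩
  t (r + 0) + (suc (g (r + 0)) + h)
    ≡⟨ solve 3 (λ a b c → a :+ ((con 1 :+ b) :+ c) := (a :+ b) :+ (con 1 :+ c)) refl (t (r + 0)) (g (r + 0)) h ⟩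
  (t (r + 0) + g (r + 0)) + suc h
    ≡⟨ cong (_+ suc h) (m∸n+n≡m (g≤f (r + 0))) ⟩
  f (r + 0) + suc h
    ≡⟨ cong (λ z → f z + suc h) (+-identityʳ r) ⟩
  f r + suc h ∎
  where
  open ≡-Reasoning
  t : ℕ → ℕ
  t i = f i ∸ g i
  first : suc (g (r + 0)) ≡ f (suc r)
  first = trans (linked 0 (s≤s z≤n)) (cong f (trans (+-suc r 0) (cong suc (+-identityʳ r))))
  linked′ : ∀ i → i < h → suc (g (suc r + i)) ≡ f (suc r + suc i)
  linked′ i i<h = trans (cong (λ z → suc (g z)) (sym (+-suc r i)))
                    (trans (linked (suc i) (s≤s i<h)) (cong f (+-suc r (suc i))))

window-split : ∀ r h N → r + h < N → ∃[ e ] (N ≡ r + (suc h + e))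
window-split r h N lt with m≤n⇒∃[o]m+o≡n lt
... | e , eq = e , sym (trans (trans (sym (+-assoc r (suc h) e)) (cong (_+ e) (+-suc r h))) eq)

record RibbonShape (b ℓ : ℕ) (λ′ ν : List ℕ) : Set where
  field
    r h k      : ℕ
    rows-split : b ≡ r + (suc h + k)
    above      : ∀ i → i < r → row ν i ≡ row λ′ i
    linked     : ∀ i → i < h → suc (row ν (r + i)) ≡ row λ′ (r + suc i)
    below      : ∀ j → r + h < j → row ν j ≡ row λ′ j
    height     : skewRows λ′ ν ≡ suc h
    size       : row ν (r + h) + ℓ ≡ row λ′ r + h

module RibbonGeometry (b ℓ : ℕ) (λ′ ν : List ℕ) (partλ : IsPartition λ′) (partν : IsPartition ν)
                      (short : ∀ i → b ≤ i → row λ′ i ≡ 0) (ribbon : IsRibbon ℓ λ′ ν) where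

  ν⊆λ : ν ⊆ᵈ λ′
  ν⊆λ = proj₁ ribbon

  Occupied? : Decidable (Occupied λ′ ν)
  Occupied? i = row ν i <? row λ′ i

  unoccupied⇒equal : ∀ i → ¬ Occupied λ′ ν i → row ν i ≡ row λ′ i
  unoccupied⇒equal i free = ≤-antisym (ν⊆λ i) (≮⇒≥ free)

  unoccupied⇒empty : ∀ i → ¬ Occupied λ′ ν i → row λ′ i ∸ row ν i ≡ 0
  unoccupied⇒empty i free = m≤n⇒m∸n≡0 (≮⇒≥ free)

  occupied⇒<b : ∀ i → Occupied λ′ ν i → i < b
  occupied⇒<b i occ with i <? b
  ... | yes i<b = i<b
  ... | no  i≮b = ⊥-elim (<-irrefl (sym (short i (≮⇒≥ i≮b))) (≤-<-trans z≤n occ))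

  module BetweenEnds (r h : ℕ) (occ-first : Occupied λ′ ν r) (occ-last : Occupied λ′ ν (r + h))
                     (before : ∀ i → i < r → ¬ Occupied λ′ ν i)
                     (after : ∀ j → r + h < j → ¬ Occupied λ′ ν j) where

    -- consecutive rows overlap in exactly one column (connected, no 2×2)
    linked : ∀ i → i < h → suc (row ν (r + i)) ≡ row λ′ (r + suc i)
    linked i i<h = trans
      (≤-antisym (connected⇒overlap λ′ ν (proj₁ (proj₂ (proj₂ ribbon))) r (r + h) occ-first occ-last
                                    (r + i) (m≤m+n r i) (+-monoʳ-< r i<h))
                 (no2×2⇒overlap≤1 λ′ ν partλ partν (proj₂ (proj₂ (proj₂ ribbon))) (r + i)))
      (cong (row λ′) (sym (+-suc r i)))

    inside : ∀ i → i < suc h → Occupied λ′ ν (r + i)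
    inside i (s≤s i≤h) with m≤n⇒m<n∨m≡n i≤h
    ... | inj₁ i<h  = ≤-trans (≤-reflexive (trans (linked i i<h) (cong (row λ′) (+-suc r i)))) (partλ (r + i))
    ... | inj₂ refl = occ-last

    beyond : ∀ i → ¬ Occupied λ′ ν (r + (suc h + i))
    beyond i = after _ (+-monoʳ-< r (s≤s (m≤m+n h i)))

    lengthSplit : ∃[ e ] (length λ′ ≡ r + (suc h + e))
    lengthSplit = window-split r h (length λ′) (nonzero-row⇒<length λ′ (r + h) (≤-<-trans z≤n occ-last))

    height : skewRows λ′ ν ≡ suc h
    height with lengthSplit
    ... | e , length≡ = trans (cong (countUpTo Occupied? (λ i → i)) length≡)
                              (countUpTo-window Occupied? r h e before inside beyond)

    boxes : sumUpTo (λ i → row λ′ i ∸ row ν i) (r +_) (suc h) ≡ ℓ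
    boxes with lengthSplit
    ... | e , length≡ = begin
      sumUpTo (λ i → row λ′ i ∸ row ν i) (r +_) (suc h)
        ≡⟨ sym (sumUpTo-window _ r h e (λ i i<r → unoccupied⇒empty i (before i i<r))
                                       (λ i → unoccupied⇒empty _ (beyond i))) ⟩
      sumUpTo (λ i → row λ′ i ∸ row ν i) (λ i → i) (r + (suc h + e))
        ≡⟨ cong (sumUpTo (λ i → row λ′ i ∸ row ν i) (λ i → i)) (sym length≡) ⟩
      skewSize λ′ ν
        ≡⟨ proj₁ (proj₂ ribbon) ⟩
      ℓ ∎
      where open ≡-Reasoning

    size : row ν (r + h) + ℓ ≡ row λ′ r + h
    size = begin
      row ν (r + h) + ℓ
        ≡⟨ cong (row ν (r + h) +_) (sym boxes) ⟩
      row ν (r + h) + sumUpTo (λ i → row λ′ i ∸ row ν i) (r +_) (suc h)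
        ≡⟨ +-comm (row ν (r + h)) _ ⟩
      sumUpTo (λ i → row λ′ i ∸ row ν i) (r +_) (suc h) + row ν (r + h)
        ≡⟨ ribbon-telescope (row λ′) (row ν) h r ν⊆λ linked ⟩
      row λ′ r + h ∎
      where open ≡-Reasoning

    shape : ∀ k → b ≡ r + (suc h + k) → RibbonShape b ℓ λ′ ν
    shape k b≡ = record
      { r = r ; h = h ; k = k ; rows-split = b≡
      ; above  = λ i i<r → unoccupied⇒equal i (before i i<r)
      ; linked = linked
      ; below  = λ j r+h<j → unoccupied⇒equal j (after j r+h<j)
      ; height = height
      ; size   = size }

  ribbonShape : 0 < ℓ → RibbonShape b ℓ λ′ ν
  ribbonShape 0<ℓ with least Occupied? b | greatest Occupied? b
  ... | inj₂ none | _ = ⊥-elim (<-irrefl (trans (sym noBoxes) (proj₁ (proj₂ ribbon))) 0<ℓ)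
    where
    noBoxes : skewSize λ′ ν ≡ 0
    noBoxes = sumUpTo-zero _ (λ i → i) (length λ′)
                (λ i _ → unoccupied⇒empty i (λ occ → none i (occupied⇒<b i occ) occ))
  ... | inj₁ (r , _ , occ , minimal) | inj₂ none = ⊥-elim (none r (occupied⇒<b r occ) occ)
  ... | inj₁ (r , _ , occ , minimal) | inj₁ (r′ , r′<b , occ′ , maximal)
    with m≤n⇒∃[o]m+o≡n (≮⇒≥ (λ r′<r → minimal r′ r′<r occ′))
  ...   | h , refl with window-split r h b r′<b
  ...     | k , b≡ = BetweenEnds.shape r h occ occ′ minimal after k b≡
    where
    after : ∀ j → r + h < j → ¬ Occupied λ′ ν j
    after j r+h<j occ-j = maximal j r+h<j (occupied⇒<b j occ-j) occ-j

record RibbonMove (b ℓ : ℕ) (λ′ ν : List ℕ) : Set where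
  field
    x y     : ℕ
    M       : List ℕ
    move    : BeadMove (betas b (row λ′)) (betas b (row ν)) x y M
    drop    : y + ℓ ≡ x
    between : All (λ m → y < m × m < x) M
    legs    : skewRows λ′ ν ∸ 1 ≡ length M

-- The jumped beads lie below the old position x = λ′_r + h + k + 1: they
-- come from rows r + 1, …, r + h of λ′, which are no longer than row r.
jumped-below-source : ∀ λ′ → IsPartition λ′ → ∀ r h k →
  All (λ m → m < row λ′ r + (suc h + k)) (topBetas h k (λ i → row λ′ (r + suc i)))
jumped-below-source λ′ partλ r h k =
  All.map (λ m≤ → ≤-trans (s≤s m≤) (≤-reflexive (sym (+-suc (row λ′ r) (h + k)))))
    (topBetas-≤ h k (λ i → row λ′ (r + suc i)) (row λ′ r)
      (λ j _ → partition-antitone λ′ partλ r (r + suc j) (m≤m+n r (suc j))))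

-- The jumped beads lie above the new position y = ν_{r+h} + k + 1: rows
-- r + 1, …, r + h of λ′ are at least as long as λ′_{r+h} > ν_{r+h}.
jumped-above-target : ∀ λ′ ν → IsPartition λ′ → IsPartition ν → ∀ r h k →
  (∀ i → i < h → suc (row ν (r + i)) ≡ row λ′ (r + suc i)) →
  All (λ m → row ν (r + h) + suc k < m) (topBetas h k (λ i → row λ′ (r + suc i)))
jumped-above-target λ′ ν partλ partν r zero    k linked = []
jumped-above-target λ′ ν partλ partν r (suc h) k linked =
  All.map (λ m≥ → <-≤-trans (+-monoˡ-< (suc k) lastOccupied) m≥)
    (topBetas-≥ (suc h) k (λ i → row λ′ (r + suc i)) (row λ′ (r + suc h))
      (λ j j<h → partition-antitone λ′ partλ (r + suc j) (r + suc h) (+-monoʳ-≤ r j<h)))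
  where
  lastOccupied : row ν (r + suc h) < row λ′ (r + suc h)
  lastOccupied = subst (_< row λ′ (r + suc h)) (cong (row ν) (sym (+-suc r h)))
    (<-≤-trans (s≤s (partν (r + h))) (≤-reflexive (linked h ≤-refl)))

ribbonMove : ∀ b ℓ λ′ ν → IsPartition λ′ → IsPartition ν → (∀ i → b ≤ i → row λ′ i ≡ 0) →
  0 < ℓ → IsRibbon ℓ λ′ ν → RibbonMove b ℓ λ′ ν
ribbonMove b ℓ λ′ ν partλ partν short 0<ℓ ribbon = record
  { x = x ; y = y ; M = M ; move = move ; drop = drop
  ; between = All.zip (jumped-above-target λ′ ν partλ partν r h k linked , jumped-below-source λ′ partλ r h k)
  ; legs = trans (cong (_∸ 1) height) (sym (length-topBetas h k _)) }
  where
  open RibbonShape (RibbonGeometry.ribbonShape b ℓ λ′ ν partλ partν short ribbon 0<ℓ)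
  x y : ℕ
  x = row λ′ r + (suc h + k)
  y = row ν (r + h) + suc k
  M : List ℕ
  M = topBetas h k (λ i → row λ′ (r + suc i))
  move : BeadMove (betas b (row λ′)) (betas b (row ν)) x y M
  move = subst (λ n → BeadMove (betas n (row λ′)) (betas n (row ν)) x y M) (sym rows-split)
           (betas-beadMove r h k (row λ′) (row ν) above linked below)
  drop : y + ℓ ≡ x
  drop = begin
    row ν (r + h) + suc k + ℓ ≡⟨ solve 3 (λ a b c → (a :+ b) :+ c := (a :+ c) :+ b) refl (row ν (r + h)) (suc k) ℓ ⟩
    row ν (r + h) + ℓ + suc k ≡⟨ cong (_+ suc k) size ⟩
    row λ′ r + h + suc k      ≡⟨ +-assoc (row λ′ r) h (suc k) ⟩
    row λ′ r + (h + suc k)    ≡⟨ cong (row λ′ r +_) (+-suc h k) ⟩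
    x                         ∎
    where open ≡-Reasoning

ind : ∀ {p} {P : Set p} → Dec P → ℕ
ind (yes _) = 1
ind (no  _) = 0

count : ∀ {P : ℕ → Set} → Decidable P → List ℕ → ℕ
count P? []      = 0
count P? (z ∷ L) = ind (P? z) + count P? L

count-++ : ∀ {P : ℕ → Set} (P? : Decidable P) A B → count P? (A ++ B) ≡ count P? A + count P? B
count-++ P? []      B = refl
count-++ P? (z ∷ A) B = trans (cong (ind (P? z) +_) (count-++ P? A B)) (sym (+-assoc (ind (P? z)) _ _))

above# below# equal# : ℕ → List ℕ → ℕ
above# x = count (x <?_)
below# x = count (_<? x)
equal# x = count (x ≟_)

-- pairs (earlier entry, later entry) in increasing order
inversions : List ℕ → ℕ
inversions []      = 0
inversions (x ∷ L) = above# x L + inversions L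

crossings : List ℕ → List ℕ → ℕ
crossings []      Q = 0
crossings (p ∷ P) Q = above# p Q + crossings P Q

crossings-++ : ∀ P A B → crossings P (A ++ B) ≡ crossings P A + crossings P B
crossings-++ []      A B = refl
crossings-++ (p ∷ P) A B rewrite count-++ (p <?_) A B | crossings-++ P A B =
  solve 4 (λ a b c d → (a :+ b) :+ (c :+ d) := (a :+ c) :+ (b :+ d)) refl
    (above# p A) (above# p B) (crossings P A) (crossings P B)

crossings-singleton : ∀ Q x → crossings Q (x ∷ []) ≡ below# x Q
crossings-singleton []      x = refl
crossings-singleton (q ∷ Q) x = cong₂ _+_ (+-identityʳ (ind (q <? x))) (crossings-singleton Q x)

inversions-++ : ∀ P Q → inversions (P ++ Q) ≡ inversions P + crossings P Q + inversions Q
inversions-++ []      Q = refl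
inversions-++ (p ∷ P) Q rewrite inversions-++ P Q | count-++ (p <?_) P Q =
  solve 5 (λ a b c d e → (a :+ b) :+ ((c :+ d) :+ e) := ((a :+ c) :+ (b :+ d)) :+ e) refl
    (above# p P) (above# p Q) (inversions P) (crossings P Q) (inversions Q)

trichotomy# : ∀ x L → above# x L + below# x L + equal# x L ≡ length L
trichotomy# x []      = refl
trichotomy# x (z ∷ L) = begin
  (ind (x <? z) + above# x L) + (ind (z <? x) + below# x L) + (ind (x ≟ z) + equal# x L)
    ≡⟨ solve 6 (λ a b c d e f → ((a :+ b) :+ (c :+ d)) :+ (e :+ f) := ((a :+ c) :+ e) :+ ((b :+ d) :+ f)) refl
         (ind (x <? z)) (above# x L) (ind (z <? x)) (below# x L) (ind (x ≟ z)) (equal# x L) ⟩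
  (ind (x <? z) + ind (z <? x) + ind (x ≟ z)) + (above# x L + below# x L + equal# x L)
    ≡⟨ cong₂ _+_ (one-of x z) (trichotomy# x L) ⟩
  suc (length L) ∎
  where
  open ≡-Reasoning
  one-of : ∀ x z → ind (x <? z) + ind (z <? x) + ind (x ≟ z) ≡ 1
  one-of x z with x <? z | z <? x | x ≟ z
  ... | yes x<z | yes z<x | _        = ⊥-elim (<-asym x<z z<x)
  ... | yes x<z | no  _   | yes refl = ⊥-elim (<-irrefl refl x<z)
  ... | yes _   | no  _   | no  _    = refl
  ... | no  _   | yes z<x | yes refl = ⊥-elim (<-irrefl refl z<x)
  ... | no  _   | yes _   | no  _    = refl
  ... | no  _   | no  _   | yes _    = refl
  ... | no  x≮z | no  z≮x | no  x≢z  = ⊥-elim (x≢z (≤-antisym (≮⇒≥ z≮x) (≮⇒≥ x≮z)))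

equal#-none : ∀ x L → All (λ m → ¬ x ≡ m) L → equal# x L ≡ 0
equal#-none x []      []            = refl
equal#-none x (z ∷ L) (x≢z ∷ others) with x ≟ z
... | yes x≡z = ⊥-elim (x≢z x≡z)
... | no  _   = equal#-none x L others

parity-+-double : ∀ n m → parity (n + (m + m)) ≡ parity n
parity-+-double n m = begin
  parity (n + (m + m))                    ≡⟨ ℙ.+-homo-+ n (m + m) ⟩
  parity n ℙ.+ parity (m + m)             ≡⟨ cong (parity n ℙ.+_) (ℙ.+-homo-+ m m) ⟩
  parity n ℙ.+ (parity m ℙ.+ parity m)    ≡⟨ cong (parity n ℙ.+_) (ℙ.p+p≡0ℙ (parity m)) ⟩
  parity n ℙ.+ 0ℙ                         ≡⟨ ℙ.+-identityʳ (parity n) ⟩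
  parity n                                ∎
  where open ≡-Reasoning

parity-suc : ∀ n → parity (suc n) ≡ parity n ℙ.⁻¹
parity-suc n = trans (sym (ℙ.⁻¹-involutive (parity (suc n)))) (cong ℙ._⁻¹ (ℙ.suc-homo-⁻¹ n))

-- Moving x from before the block M to after it changes the number of
-- inversions from C + #(M above x) to C + #(M below x).
inversions-move : ∀ P x M S →
  parity (inversions (P ++ (x ∷ M ++ S))) ≡
  parity (inversions (P ++ (M ++ (x ∷ S)))) ℙ.+ parity (above# x M + below# x M)
inversions-move P x M S = begin
  parity (inversions (P ++ (x ∷ M ++ S)))
    ≡⟨ cong parity before ⟩
  parity (C + A)
    ≡⟨ sym (parity-+-double (C + A) B) ⟩
  parity ((C + A) + (B + B))
    ≡⟨ cong parity (solve 3 (λ c a b → (c :+ a) :+ (b :+ b) := (c :+ b) :+ (a :+ b)) refl C A B) ⟩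
  parity ((C + B) + (A + B))
    ≡⟨ ℙ.+-homo-+ (C + B) (A + B) ⟩
  parity (C + B) ℙ.+ parity (A + B)
    ≡⟨ cong (λ n → parity n ℙ.+ parity (A + B)) (sym after) ⟩
  parity (inversions (P ++ (M ++ (x ∷ S)))) ℙ.+ parity (A + B) ∎
  where
  open ≡-Reasoning
  A B C : ℕ
  A = above# x M
  B = below# x M
  C = inversions P + crossings P (x ∷ []) + crossings P M + crossings P S
      + above# x S + inversions M + crossings M S + inversions S
  before : inversions (P ++ (x ∷ M ++ S)) ≡ C + A
  before rewrite inversions-++ P (x ∷ M ++ S) | crossings-++ P (x ∷ []) (M ++ S) | crossings-++ P M S
               | count-++ (x <?_) M S | inversions-++ M S =
    solve 9 (λ a b c d e f g h i → ((a :+ (b :+ (c :+ d))) :+ ((e :+ f) :+ ((g :+ h) :+ i)))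
      := (((((((a :+ b) :+ c) :+ d) :+ f) :+ g) :+ h) :+ i) :+ e) refl
      (inversions P) (crossings P (x ∷ [])) (crossings P M) (crossings P S) A (above# x S)
      (inversions M) (crossings M S) (inversions S)
  after : inversions (P ++ (M ++ (x ∷ S))) ≡ C + B
  after rewrite inversions-++ P (M ++ (x ∷ S)) | crossings-++ P M (x ∷ S) | crossings-++ P (x ∷ []) S
              | inversions-++ M (x ∷ S) | crossings-++ M (x ∷ []) S | crossings-singleton M x =
    solve 9 (λ a b c d e f g h i → ((a :+ (c :+ (b :+ d))) :+ ((g :+ (e :+ h)) :+ (f :+ i)))
      := (((((((a :+ b) :+ c) :+ d) :+ f) :+ g) :+ h) :+ i) :+ e) refl
      (inversions P) (crossings P (x ∷ [])) (crossings P M) (crossings P S) B (above# x S)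
      (inversions M) (crossings M S) (inversions S)

residues : ℕ → List ℕ → List ℕ
residues l = map (_% suc l)

%-distinct : ∀ l y t → 0 < t → t < suc l → ¬ (y + t) % suc l ≡ y % suc l
%-distinct l y t 0<t t<ℓ same = <⇒≱ t<ℓ (∣⇒≤ ⦃ >-nonZero 0<t ⦄ ℓ∣t)
  where
  ℓ = suc l
  quotients : (y / ℓ) * ℓ + t ≡ ((y + t) / ℓ) * ℓ
  quotients = +-cancelʳ-≡ (y % ℓ) _ _ (begin
    ((y / ℓ) * ℓ + t) + y % ℓ ≡⟨ solve 3 (λ a b c → (a :+ b) :+ c := (c :+ a) :+ b) refl ((y / ℓ) * ℓ) t (y % ℓ) ⟩
    (y % ℓ + (y / ℓ) * ℓ) + t ≡⟨ cong (_+ t) (sym (m≡m%n+[m/n]*n y ℓ)) ⟩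
    y + t                     ≡⟨ m≡m%n+[m/n]*n (y + t) ℓ ⟩
    (y + t) % ℓ + ((y + t) / ℓ) * ℓ ≡⟨ cong (_+ ((y + t) / ℓ) * ℓ) same ⟩
    y % ℓ + ((y + t) / ℓ) * ℓ ≡⟨ +-comm (y % ℓ) _ ⟩
    ((y + t) / ℓ) * ℓ + y % ℓ ∎)
    where open ≡-Reasoning
  ℓ∣t : ℓ ∣ t
  ℓ∣t = ∣m+n∣m⇒∣n (divides ((y + t) / ℓ) quotients) (n∣m*n (y / ℓ))

between⇒other-residue : ∀ l y m → y < m → m < y + suc l → ¬ (y + suc l) % suc l ≡ m % suc l
between⇒other-residue l y m y<m m<y+ℓ same =
  %-distinct l y (m ∸ y) (n≢0⇒n>0 (m>n⇒m∸n≢0 y<m)) t<ℓ (begin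
    (y + (m ∸ y)) % suc l ≡⟨ cong (_% suc l) (m+[n∸m]≡n (<⇒≤ y<m)) ⟩
    m % suc l             ≡⟨ sym same ⟩
    (y + suc l) % suc l   ≡⟨ [m+n]%n≡m%n y (suc l) ⟩
    y % suc l             ∎)
  where
  open ≡-Reasoning
  t<ℓ : m ∸ y < suc l
  t<ℓ = +-cancelˡ-< y _ _ (subst (_< y + suc l) (sym (m+[n∸m]≡n (<⇒≤ y<m))) m<y+ℓ)

beadMove-parity : ∀ l {L L′ x y M} → BeadMove L L′ x y M → y + suc l ≡ x →
  All (λ m → y < m × m < x) M →
  parity (inversions (residues l L)) ≡ parity (inversions (residues l L′)) ℙ.+ parity (length M)
beadMove-parity l {x = x} {y} {M} (beadMove P S refl refl) refl between = begin
  parity (inversions (res (P ++ (x ∷ M ++ S))))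
    ≡⟨ cong (parity ∘ inversions) (trans (map-++ r P _) (cong (λ z → res P ++ (r x ∷ z)) (map-++ r M S))) ⟩
  parity (inversions (res P ++ (r x ∷ res M ++ res S)))
    ≡⟨ inversions-move (res P) (r x) (res M) (res S) ⟩
  parity (inversions (res P ++ (res M ++ (r x ∷ res S)))) ℙ.+ parity (above# (r x) (res M) + below# (r x) (res M))
    ≡⟨ cong₂ (λ z n → parity (inversions (res P ++ (res M ++ (z ∷ res S)))) ℙ.+ parity n)
             ([m+n]%n≡m%n y (suc l)) jumped ⟩
  parity (inversions (res P ++ (res M ++ (r y ∷ res S)))) ℙ.+ parity (length M)
    ≡⟨ cong (λ L → parity (inversions L) ℙ.+ parity (length M))
            (sym (trans (map-++ r P _) (cong (res P ++_) (map-++ r M (y ∷ S))))) ⟩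
  parity (inversions (res (P ++ (M ++ (y ∷ S))))) ℙ.+ parity (length M) ∎
  where
  open ≡-Reasoning
  r : ℕ → ℕ
  r = _% suc l
  res : List ℕ → List ℕ
  res = residues l
  others : All (λ m → ¬ r x ≡ m) (res M)
  others = AllP.map⁺ (All.map (λ { (y<m , m<x) → between⇒other-residue l y _ y<m m<x }) between)
  jumped : above# (r x) (res M) + below# (r x) (res M) ≡ length M
  jumped = begin
    above# (r x) (res M) + below# (r x) (res M)     ≡⟨ sym (+-identityʳ _) ⟩
    above# (r x) (res M) + below# (r x) (res M) + 0 ≡⟨ cong (above# (r x) (res M) + below# (r x) (res M) +_) (sym (equal#-none (r x) (res M) others)) ⟩
    above# (r x) (res M) + below# (r x) (res M) + equal# (r x) (res M) ≡⟨ trichotomy# (r x) (res M) ⟩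
    length (res M)                                  ≡⟨ length-map r M ⟩
    length M                                        ∎

legLength : ∀ {ℓ λ′} → RibbonDecomp ℓ λ′ → ℕ
legLength (done _) = 0
legLength {λ′ = λ′} (remove ν _ _ D) = (skewRows λ′ ν ∸ 1) + legLength D

residueParity : ℕ → ℕ → (ℕ → ℕ) → Parity
residueParity b l f = parity (inversions (residues l (betas b f)))

legLength-parity : ∀ b l λ′ → IsPartition λ′ → (∀ i → b ≤ i → row λ′ i ≡ 0) →
  (D : RibbonDecomp (suc l) λ′) →
  parity (legLength D) ≡ residueParity b l (row λ′) ℙ.+ residueParity b l (λ _ → 0)
legLength-parity b l λ′ partλ short (done empty) = begin
  0ℙ                                                     ≡⟨ sym (ℙ.p+p≡0ℙ I₀) ⟩
  I₀ ℙ.+ I₀                                              ≡⟨ cong (λ L → parity (inversions (residues l L)) ℙ.+ I₀)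
                                                                 (betas-cong b _ _ (λ i _ → sym (empty i))) ⟩
  residueParity b l (row λ′) ℙ.+ I₀ ∎
  where
  open ≡-Reasoning
  I₀ : Parity
  I₀ = residueParity b l (λ _ → 0)
legLength-parity b l λ′ partλ short (remove ν partν ribbon D) = begin
  parity ((skewRows λ′ ν ∸ 1) + legLength D)
    ≡⟨ ℙ.+-homo-+ (skewRows λ′ ν ∸ 1) (legLength D) ⟩
  parity (skewRows λ′ ν ∸ 1) ℙ.+ parity (legLength D)
    ≡⟨ cong₂ ℙ._+_ (cong parity legs) (legLength-parity b l ν partν shortν D) ⟩
  parity (length M) ℙ.+ (Iν ℙ.+ I₀)
    ≡⟨ sym (ℙ.+-assoc (parity (length M)) Iν I₀) ⟩
  (parity (length M) ℙ.+ Iν) ℙ.+ I₀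
    ≡⟨ cong (ℙ._+ I₀) (trans (ℙ.+-comm (parity (length M)) Iν)
         (sym (beadMove-parity l move drop between))) ⟩
  residueParity b l (row λ′) ℙ.+ I₀ ∎
  where
  open ≡-Reasoning
  open RibbonMove (ribbonMove b (suc l) λ′ ν partλ partν short (s≤s z≤n) ribbon)
  Iν I₀ : Parity
  Iν = residueParity b l (row ν)
  I₀ = residueParity b l (λ _ → 0)
  shortν : ∀ i → b ≤ i → row ν i ≡ 0
  shortν i b≤i = n≤0⇒n≡0 (subst (row ν i ≤_) (short i b≤i) (proj₁ ribbon i))

topBetas-const : ∀ m n s → topBetas m n (λ _ → s) ≡ betas m (λ _ → s + n)
topBetas-const zero    n s = refl
topBetas-const (suc m) n s = cong₂ _∷_ (trans (cong (s +_) (+-comm (suc m) n)) (sym (+-assoc s n (suc m))))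
                                      (topBetas-const m n s)

betas-const-split : ∀ m n s → betas (m + n) (λ _ → s) ≡ betas m (λ _ → s + n) ++ betas n (λ _ → s)
betas-const-split m n s = trans (betas-split m n (λ _ → s)) (cong (_++ betas n (λ _ → s)) (topBetas-const m n s))

betas-const-snoc : ∀ n s → betas (suc n) (λ _ → s) ≡ betas n (λ _ → suc s) ++ (suc s ∷ [])
betas-const-snoc n s = begin
  betas (suc n) (λ _ → s)                        ≡⟨ cong (λ k → betas k (λ _ → s)) (+-comm 1 n) ⟩
  betas (n + 1) (λ _ → s)                        ≡⟨ betas-const-split n 1 s ⟩
  betas n (λ _ → s + 1) ++ (s + 1 ∷ [])          ≡⟨ cong (λ k → betas n (λ _ → k) ++ (k ∷ [])) (+-comm s 1) ⟩
  betas n (λ _ → suc s) ++ (suc s ∷ [])          ∎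
  where open ≡-Reasoning

module ResidueCounts (l : ℕ) where

  ℓ : ℕ
  ℓ = suc l

  countdown : ℕ → List ℕ
  countdown n = betas n (λ _ → 0)

  countdown-residues : ∀ n → n < ℓ → residues l (countdown n) ≡ countdown n
  countdown-residues zero    _   = refl
  countdown-residues (suc n) n<ℓ = cong₂ _∷_ (m<n⇒m%n≡m n<ℓ) (countdown-residues n (<-trans (n<1+n n) n<ℓ))

  equal#-countdown-above : ∀ n ρ → n < ρ → equal# ρ (countdown n) ≡ 0
  equal#-countdown-above zero    ρ _   = refl
  equal#-countdown-above (suc n) ρ n<ρ with ρ ≟ suc n
  ... | yes refl = ⊥-elim (<-irrefl refl n<ρ)
  ... | no  _    = equal#-countdown-above n ρ (<-trans (n<1+n n) n<ρ)

  equal#-countdown-zero : ∀ n → equal# 0 (countdown n) ≡ 0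
  equal#-countdown-zero zero    = refl
  equal#-countdown-zero (suc n) = equal#-countdown-zero n

  equal#-countdown-inside : ∀ n ρ → 0 < ρ → ρ ≤ n → equal# ρ (countdown n) ≡ 1
  equal#-countdown-inside zero    zero    () z≤n
  equal#-countdown-inside (suc n) ρ 0<ρ ρ≤n with ρ ≟ suc n
  ... | yes refl = cong suc (equal#-countdown-above n (suc n) (n<1+n n))
  ... | no  ρ≢n  = equal#-countdown-inside n ρ 0<ρ (≤-pred (≤∧≢⇒< ρ≤n ρ≢n))

  -- ℓ consecutive beads hit every residue exactly once …
  window : ∀ t ρ → ρ < ℓ → equal# ρ (residues l (betas ℓ (λ _ → t))) ≡ 1
  window zero ρ ρ<ℓ = trans (cong (equal# ρ) (cong₂ _∷_ (n%n≡0 ℓ) (countdown-residues l ≤-refl))) (first ρ ρ<ℓ)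
    where
    first : ∀ ρ → ρ < ℓ → equal# ρ (0 ∷ countdown l) ≡ 1
    first zero     _   = cong suc (equal#-countdown-zero l)
    first (suc ρ′) ρ<ℓ = equal#-countdown-inside l (suc ρ′) (s≤s z≤n) (≤-pred ρ<ℓ)
  -- … and shifting the window by one replaces t + 1 by t + 1 + ℓ, of the same residue
  window (suc t) ρ ρ<ℓ = begin
    ind (ρ ≟ (suc t + ℓ) % ℓ) + equal# ρ (res Z)
      ≡⟨ cong (λ z → ind (ρ ≟ z) + equal# ρ (res Z)) ([m+n]%n≡m%n (suc t) ℓ) ⟩
    ind (ρ ≟ suc t % ℓ) + equal# ρ (res Z)
      ≡⟨ trans (+-comm (ind (ρ ≟ suc t % ℓ)) _) (cong (equal# ρ (res Z) +_) (sym (+-identityʳ _))) ⟩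
    equal# ρ (res Z) + equal# ρ (res (suc t ∷ []))
      ≡⟨ sym (count-++ (ρ ≟_) (res Z) (res (suc t ∷ []))) ⟩
    equal# ρ (res Z ++ res (suc t ∷ []))
      ≡⟨ cong (equal# ρ) (sym (map-++ (_% ℓ) Z _)) ⟩
    equal# ρ (res (Z ++ (suc t ∷ [])))
      ≡⟨ cong (λ L → equal# ρ (res L)) (sym (betas-const-snoc l t)) ⟩
    equal# ρ (res (betas ℓ (λ _ → t)))
      ≡⟨ window t ρ ρ<ℓ ⟩
    1 ∎
    where
    open ≡-Reasoning
    res : List ℕ → List ℕ
    res = residues l
    Z : List ℕ
    Z = betas l (λ _ → suc t)

  windows : ∀ c t ρ → ρ < ℓ → equal# ρ (residues l (betas (c * ℓ) (λ _ → t))) ≡ c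
  windows zero    t ρ _   = refl
  windows (suc c) t ρ ρ<ℓ = begin
    equal# ρ (residues l (betas (ℓ + c * ℓ) (λ _ → t)))
      ≡⟨ cong (λ L → equal# ρ (residues l L)) (betas-const-split ℓ (c * ℓ) t) ⟩
    equal# ρ (residues l (betas ℓ (λ _ → t + c * ℓ) ++ betas (c * ℓ) (λ _ → t)))
      ≡⟨ cong (equal# ρ) (map-++ (_% ℓ) (betas ℓ (λ _ → t + c * ℓ)) _) ⟩
    equal# ρ (residues l (betas ℓ (λ _ → t + c * ℓ)) ++ residues l (betas (c * ℓ) (λ _ → t)))
      ≡⟨ count-++ (ρ ≟_) (residues l (betas ℓ (λ _ → t + c * ℓ))) _ ⟩
    equal# ρ (residues l (betas ℓ (λ _ → t + c * ℓ))) + equal# ρ (residues l (betas (c * ℓ) (λ _ → t)))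
      ≡⟨ cong₂ _+_ (window (t + c * ℓ) ρ ρ<ℓ) (windows c t ρ ρ<ℓ) ⟩
    suc c ∎
    where open ≡-Reasoning

  -- In the run s + cℓ, …, s + 1, the bead s + 1 shares its residue with
  -- exactly c − 1 of the other beads, so c(ℓ − 1) of them are above or
  -- below it in residue.
  other-residues : ∀ n c s → suc n ≡ c * ℓ →
    let Z = residues l (betas n (λ _ → suc s)) in above# (suc s % ℓ) Z + below# (suc s % ℓ) Z ≡ c * l
  other-residues n c s b≡ = +-cancelʳ-≡ (equal# X Z) _ _ (suc-injective (begin
    suc (above# X Z + below# X Z + equal# X Z) ≡⟨ cong suc (trichotomy# X Z) ⟩
    suc (length Z)                             ≡⟨ cong suc (trans (length-map (_% ℓ) (betas n _)) (length-betas n _)) ⟩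
    suc n                                      ≡⟨ b≡ ⟩
    c * ℓ                                      ≡⟨ *-suc c l ⟩
    c + c * l                                  ≡⟨ cong (_+ c * l) (sym sameResidue) ⟩
    equal# X Z + 1 + c * l                     ≡⟨ solve 2 (λ e m → (e :+ con 1) :+ m := con 1 :+ (m :+ e)) refl (equal# X Z) (c * l) ⟩
    suc (c * l + equal# X Z)                   ∎))
    where
    open ≡-Reasoning
    X : ℕ
    X = suc s % ℓ
    Z : List ℕ
    Z = residues l (betas n (λ _ → suc s))
    self : ind (X ≟ X) ≡ 1
    self with X ≟ X
    ... | yes _  = refl
    ... | no X≢X = ⊥-elim (X≢X refl)
    sameResidue : equal# X Z + 1 ≡ c
    sameResidue = begin
      equal# X Z + 1                   ≡⟨ cong (λ k → equal# X Z + (k + 0)) (sym self) ⟩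
      equal# X Z + equal# X (X ∷ [])   ≡⟨ sym (count-++ (X ≟_) Z (X ∷ [])) ⟩
      equal# X (Z ++ (X ∷ []))         ≡⟨ cong (equal# X) (sym (map-++ (_% ℓ) (betas n _) (suc s ∷ []))) ⟩
      equal# X (residues l (betas n (λ _ → suc s) ++ (suc s ∷ [])))
                                       ≡⟨ cong (λ L → equal# X (residues l L)) (sym (betas-const-snoc n s)) ⟩
      equal# X (residues l (betas (suc n) (λ _ → s)))
                                       ≡⟨ cong (λ k → equal# X (residues l (betas k (λ _ → s)))) b≡ ⟩
      equal# X (residues l (betas (c * ℓ) (λ _ → s)))
                                       ≡⟨ windows c s X (m%n<n (suc s) ℓ) ⟩
      c                                ∎

  -- Shifting all c·ℓ beads of a run up by one moves the bead s + 1 to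
  -- s + 1 + cℓ (same residue) past the others: the inversion parity
  -- changes by c(ℓ − 1).
  shift-parity : ∀ n c s → suc n ≡ c * ℓ →
    residueParity (suc n) l (λ _ → suc s) ≡ parity (c * l) ℙ.+ residueParity (suc n) l (λ _ → s)
  shift-parity n c s b≡ = begin
    parity (inversions (((suc s + suc n) % ℓ) ∷ Z))
      ≡⟨ cong (λ z → parity (inversions (z ∷ Z))) (%-remove-+ʳ (suc s) (divides c b≡)) ⟩
    parity (inversions (X ∷ Z))
      ≡⟨ cong (λ L → parity (inversions (X ∷ L))) (sym (++-identityʳ Z)) ⟩
    parity (inversions (X ∷ Z ++ []))
      ≡⟨ inversions-move [] X Z [] ⟩
    parity (inversions (Z ++ (X ∷ []))) ℙ.+ parity (above# X Z + below# X Z)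
      ≡⟨ cong₂ (λ L n → parity (inversions L) ℙ.+ parity n) (sym snoc) (other-residues n c s b≡) ⟩
    residueParity (suc n) l (λ _ → s) ℙ.+ parity (c * l)
      ≡⟨ ℙ.+-comm _ (parity (c * l)) ⟩
    parity (c * l) ℙ.+ residueParity (suc n) l (λ _ → s) ∎
    where
    open ≡-Reasoning
    X : ℕ
    X = suc s % ℓ
    Z : List ℕ
    Z = residues l (betas n (λ _ → suc s))
    snoc : residues l (betas (suc n) (λ _ → s)) ≡ Z ++ (X ∷ [])
    snoc = trans (cong (residues l) (betas-const-snoc n s)) (map-++ (_% ℓ) (betas n (λ _ → suc s)) (suc s ∷ []))

  shifted-parity : ∀ n c → suc n ≡ c * ℓ → ∀ s →
    residueParity (suc n) l (λ _ → s) ≡ parity (s * (c * l)) ℙ.+ residueParity (suc n) l (λ _ → 0)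
  shifted-parity n c b≡ zero    = sym (ℙ.+-identityˡ _)
  shifted-parity n c b≡ (suc s) = begin
    residueParity (suc n) l (λ _ → suc s)
      ≡⟨ shift-parity n c s b≡ ⟩
    parity (c * l) ℙ.+ residueParity (suc n) l (λ _ → s)
      ≡⟨ cong (parity (c * l) ℙ.+_) (shifted-parity n c b≡ s) ⟩
    parity (c * l) ℙ.+ (parity (s * (c * l)) ℙ.+ I₀)
      ≡⟨ sym (ℙ.+-assoc (parity (c * l)) _ I₀) ⟩
    (parity (c * l) ℙ.+ parity (s * (c * l))) ℙ.+ I₀
      ≡⟨ cong (ℙ._+ I₀) (sym (ℙ.+-homo-+ (c * l) (s * (c * l)))) ⟩
    parity (suc s * (c * l)) ℙ.+ I₀ ∎
    where
    open ≡-Reasoning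
    I₀ : Parity
    I₀ = residueParity (suc n) l (λ _ → 0)

  shifted-residues : ∀ a → ℓ ∣ a → ∀ n → residues l (betas n (λ _ → a)) ≡ residues l (betas n (λ _ → 0))
  shifted-residues a ℓ∣a zero    = refl
  shifted-residues a ℓ∣a (suc n) = cong₂ _∷_ (%-remove-+ˡ (suc n) ℓ∣a) (shifted-residues a ℓ∣a n)

rect-row-< : ∀ a b i → i < b → row (rect a b) i ≡ a
rect-row-< a (suc b) zero    _         = refl
rect-row-< a (suc b) (suc i) (s≤s i<b) = rect-row-< a b i i<b

rect-row-≥ : ∀ a b i → b ≤ i → row (rect a b) i ≡ 0
rect-row-≥ a zero    i       _         = refl
rect-row-≥ a (suc b) (suc i) (s≤s b≤i) = rect-row-≥ a b i b≤i

rect-partition : ∀ a b → IsPartition (rect a b)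
rect-partition a zero           i       = z≤n
rect-partition a (suc zero)     zero    = z≤n
rect-partition a (suc (suc b))  zero    = ≤-refl
rect-partition a (suc b)        (suc i) = rect-partition a b i

-- The beta-numbers of a^b are the run a + b, …, a + 1.
rectangle-legs : ∀ a b l (D : RibbonDecomp (suc l) (rect a b)) →
  parity (legLength D) ≡ residueParity b l (λ _ → a) ℙ.+ residueParity b l (λ _ → 0)
rectangle-legs a b l D = trans (legLength-parity b l (rect a b) (rect-partition a b) (rect-row-≥ a b) D)
  (cong (λ L → parity (inversions (residues l L)) ℙ.+ residueParity b l (λ _ → 0))
        (betas-cong b _ _ (rect-row-< a b)))

-- If ℓ ∣ a, the beads of a^b and of ∅ have the same residues: ε = 1.
rectangle-legs-∣a : ∀ a b l → suc l ∣ a → (D : RibbonDecomp (suc l) (rect a b)) → parity (legLength D) ≡ 0ℙ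
rectangle-legs-∣a a b l ℓ∣a D = begin
  parity (legLength D)                                            ≡⟨ rectangle-legs a b l D ⟩
  residueParity b l (λ _ → a) ℙ.+ residueParity b l (λ _ → 0)     ≡⟨ cong (λ L → parity (inversions L) ℙ.+ residueParity b l (λ _ → 0))
                                                                        (ResidueCounts.shifted-residues l a ℓ∣a b) ⟩
  residueParity b l (λ _ → 0) ℙ.+ residueParity b l (λ _ → 0)     ≡⟨ ℙ.p+p≡0ℙ (residueParity b l (λ _ → 0)) ⟩
  0ℙ                                                              ∎
  where open ≡-Reasoning

-- If b = cℓ and ab = qℓ (so q = ac), then ε = (−1)^{ac(ℓ−1)} = (−1)^{q(ℓ−1)}.
rectangle-legs-∣b : ∀ a b l q → suc l ∣ b → a * b ≡ q * suc l →
  (D : RibbonDecomp (suc l) (rect a b)) → parity (legLength D) ≡ parity (q * l)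
rectangle-legs-∣b a zero    l q _ ab≡ D
  rewrite m*n≡0⇒m≡0 q (suc l) (trans (sym ab≡) (*-zeroʳ a)) = rectangle-legs a zero l D
rectangle-legs-∣b a (suc n) l q (divides c b≡) ab≡ D = begin
  parity (legLength D)                                     ≡⟨ rectangle-legs a (suc n) l D ⟩
  residueParity (suc n) l (λ _ → a) ℙ.+ I₀                 ≡⟨ cong (ℙ._+ I₀) (ResidueCounts.shifted-parity l n c b≡ a) ⟩
  (parity (a * (c * l)) ℙ.+ I₀) ℙ.+ I₀                     ≡⟨ ℙ.+-assoc (parity (a * (c * l))) I₀ I₀ ⟩
  parity (a * (c * l)) ℙ.+ (I₀ ℙ.+ I₀)                     ≡⟨ cong (parity (a * (c * l)) ℙ.+_) (ℙ.p+p≡0ℙ I₀) ⟩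
  parity (a * (c * l)) ℙ.+ 0ℙ                              ≡⟨ ℙ.+-identityʳ _ ⟩
  parity (a * (c * l))                                     ≡⟨ cong parity (trans (sym (*-assoc a c l)) (cong (_* l) (sym q≡ac))) ⟩
  parity (q * l)                                           ∎
  where
  open ≡-Reasoning
  I₀ : Parity
  I₀ = residueParity (suc n) l (λ _ → 0)
  q≡ac : q ≡ a * c
  q≡ac = *-cancelʳ-≡ q (a * c) (suc l) (trans (sym ab≡) (trans (cong (a *_) b≡) (sym (*-assoc a c (suc l)))))

module Signs (R : CommutativeRing 0ℓ 0ℓ) where
  module R = CommutativeRing R
  open R using (Carrier; _≈_; 1#; -_; setoid; ring; semiring; +-group) renaming (_*_ to _*ᵣ_)
  open import Relation.Binary.Reasoning.Setoid setoid
  open import Algebra.Properties.Ring ring using (-1*x≈-x)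
  open import Algebra.Properties.Group +-group using (⁻¹-involutive)
  import Algebra.Properties.Semiring.Exp semiring as Exp
  open Exp using (_^_)

  pow≡^ : ∀ x n → pow R x n ≡ x ^ n
  pow≡^ x zero    = refl
  pow≡^ x (suc n) = cong (x *ᵣ_) (pow≡^ x n)

  pow-+ : ∀ x m n → pow R x (m + n) ≈ pow R x m *ᵣ pow R x n
  pow-+ x m n rewrite pow≡^ x (m + n) | pow≡^ x m | pow≡^ x n = Exp.^-homo-* x m n

  pow-* : ∀ x m n → pow R x (m * n) ≈ pow R (pow R x m) n
  pow-* x m n rewrite pow≡^ x (m * n) | pow≡^ (pow R x m) n | pow≡^ x m = R.sym (Exp.^-assocʳ x m n)

  pow-congˡ : ∀ {x y} n → x ≈ y → pow R x n ≈ pow R y n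
  pow-congˡ {x} {y} n x≈y rewrite pow≡^ x n | pow≡^ y n = Exp.^-congˡ n x≈y

  pow-multiple : ∀ x p → pow R x p ≈ 1# → ∀ k → pow R x (k * p) ≈ 1#
  pow-multiple x p xᵖ≈1 zero    = R.refl
  pow-multiple x p xᵖ≈1 (suc k) = begin
    pow R x (p + k * p)             ≈⟨ pow-+ x p (k * p) ⟩
    pow R x p *ᵣ pow R x (k * p)    ≈⟨ R.*-cong xᵖ≈1 (pow-multiple x p xᵖ≈1 k) ⟩
    1# *ᵣ 1#                        ≈⟨ R.*-identityˡ 1# ⟩
    1#                              ∎

  sign : Parity → Carrier
  sign 0ℙ = 1#
  sign 1ℙ = - 1#

  sign-flip : ∀ p → sign (p ℙ.⁻¹) ≈ - 1# *ᵣ sign p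
  sign-flip 0ℙ = R.sym (R.*-identityʳ (- 1#))
  sign-flip 1ℙ = R.sym (R.trans (-1*x≈-x (- 1#)) (⁻¹-involutive 1#))

  negOnePow≈sign : ∀ n → negOnePow R n ≈ sign (parity n)
  negOnePow≈sign zero    = R.refl
  negOnePow≈sign (suc n) = begin
    - 1# *ᵣ negOnePow R n       ≈⟨ R.*-cong R.refl (negOnePow≈sign n) ⟩
    - 1# *ᵣ sign (parity n)     ≈⟨ R.sym (sign-flip (parity n)) ⟩
    sign (parity n ℙ.⁻¹)        ≡⟨ cong sign (sym (parity-suc n)) ⟩
    sign (parity (suc n))       ∎

  negOnePow-parity : ∀ m n → parity m ≡ parity n → negOnePow R m ≈ negOnePow R n
  negOnePow-parity m n same = begin
    negOnePow R m     ≈⟨ negOnePow≈sign m ⟩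
    sign (parity m)   ≡⟨ cong sign same ⟩
    sign (parity n)   ≈⟨ R.sym (negOnePow≈sign n) ⟩
    negOnePow R n     ∎

  negOnePow-+ : ∀ m n → negOnePow R (m + n) ≈ negOnePow R m *ᵣ negOnePow R n
  negOnePow-+ = pow-+ (- 1#)

  decompSign≈legLength : ∀ {ℓ λ′} (D : RibbonDecomp ℓ λ′) → decompSign R D ≈ negOnePow R (legLength D)
  decompSign≈legLength (done _)         = R.refl
  decompSign≈legLength {λ′ = λ′} (remove ν _ _ D) =
    R.trans (R.*-cong R.refl (decompSign≈legLength D)) (R.sym (negOnePow-+ (skewRows λ′ ν ∸ 1) (legLength D)))

module IntegralDomain (R : CommutativeRing 0ℓ 0ℓ) (domain : IsIntegralDomain R) where
  module R = CommutativeRing R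
  open R using (_≈_; 0#; 1#; -_; setoid; ring; +-group) renaming (_+_ to _+ᵣ_; _*_ to _*ᵣ_)
  open import Relation.Binary.Reasoning.Setoid setoid
  open import Algebra.Properties.Ring ring using (-‿distribˡ-*)
  open import Algebra.Properties.Group +-group using (x∙y⁻¹≈ε⇒x≈y; inverseˡ-unique)

  cancelʳ : ∀ x y z → x *ᵣ z ≈ y *ᵣ z → x ≈ y ⊎ z ≈ 0#
  cancelʳ x y z xz≈yz with proj₂ domain (x +ᵣ - y) z difference
    where
    difference : (x +ᵣ - y) *ᵣ z ≈ 0#
    difference = begin
      (x +ᵣ - y) *ᵣ z        ≈⟨ R.distribʳ z x (- y) ⟩
      x *ᵣ z +ᵣ (- y) *ᵣ z   ≈⟨ R.+-cong xz≈yz (R.sym (-‿distribˡ-* y z)) ⟩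
      y *ᵣ z +ᵣ - (y *ᵣ z)   ≈⟨ R.-‿inverseʳ _ ⟩
      0#                     ∎
  ... | inj₁ x-y≈0 = inj₁ (x∙y⁻¹≈ε⇒x≈y x y x-y≈0)
  ... | inj₂ z≈0   = inj₂ z≈0

  -- The only square roots of 1 are ±1: y (y + 1) = y + 1 = 1 (y + 1).
  square-root-of-one : ∀ y → y *ᵣ y ≈ 1# → y ≈ 1# ⊎ y ≈ - 1#
  square-root-of-one y y²≈1 with cancelʳ y 1# (y +ᵣ 1#) factored
    where
    factored : y *ᵣ (y +ᵣ 1#) ≈ 1# *ᵣ (y +ᵣ 1#)
    factored = begin
      y *ᵣ (y +ᵣ 1#)         ≈⟨ R.distribˡ y y 1# ⟩
      y *ᵣ y +ᵣ y *ᵣ 1#      ≈⟨ R.+-cong y²≈1 (R.*-identityʳ y) ⟩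
      1# +ᵣ y                ≈⟨ R.+-comm 1# y ⟩
      y +ᵣ 1#                ≈⟨ R.sym (R.*-identityˡ _) ⟩
      1# *ᵣ (y +ᵣ 1#)        ∎
  ... | inj₁ y≈1    = inj₁ y≈1
  ... | inj₂ y+1≈0  = inj₂ (inverseˡ-unique y 1# y+1≈0)

module RootSums (R : CommutativeRing 0ℓ 0ℓ) (ξ : CommutativeRing.Carrier R) (l : ℕ)
                (ξ^ℓ≈1 : CommutativeRing._≈_ R (pow R ξ (suc l)) (CommutativeRing.1# R)) where
  module R = CommutativeRing R
  open R using (Carrier; _≈_; 0#; 1#; setoid) renaming (_+_ to _+ᵣ_; _*_ to _*ᵣ_)
  open import Relation.Binary.Reasoning.Setoid setoid
  open import Algebra.Properties.CommutativeSemigroup R.+-commutativeSemigroup using (x∙yz≈y∙xz)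
  open Signs R using (pow-+)

  rootSum : List ℕ → Carrier
  rootSum []      = 0#
  rootSum (m ∷ L) = pow R ξ m +ᵣ rootSum L

  rootSum-++ : ∀ A B → rootSum (A ++ B) ≈ rootSum A +ᵣ rootSum B
  rootSum-++ []      B = R.sym (R.+-identityˡ _)
  rootSum-++ (m ∷ A) B = R.trans (R.+-cong R.refl (rootSum-++ A B)) (R.sym (R.+-assoc _ _ _))

  -- A bead move down by ℓ does not change ξ^{bead}.
  rootSum-beadMove : ∀ {L L′ x y M} → BeadMove L L′ x y M → y + suc l ≡ x → rootSum L ≈ rootSum L′
  rootSum-beadMove {x = x} {y} {M} (beadMove P S refl refl) refl = begin
    rootSum (P ++ (y + suc l ∷ M ++ S))                ≈⟨ rootSum-++ P _ ⟩
    rootSum P +ᵣ (pow R ξ (y + suc l) +ᵣ rootSum (M ++ S)) ≈⟨ R.+-cong R.refl (R.+-cong same-root (rootSum-++ M S)) ⟩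
    rootSum P +ᵣ (pow R ξ y +ᵣ (rootSum M +ᵣ rootSum S)) ≈⟨ R.+-cong R.refl (x∙yz≈y∙xz _ _ _) ⟩
    rootSum P +ᵣ (rootSum M +ᵣ (pow R ξ y +ᵣ rootSum S)) ≈⟨ R.+-cong R.refl (R.sym (rootSum-++ M (y ∷ S))) ⟩
    rootSum P +ᵣ rootSum (M ++ (y ∷ S))                ≈⟨ R.sym (rootSum-++ P _) ⟩
    rootSum (P ++ (M ++ (y ∷ S)))                      ∎
    where
    same-root : pow R ξ (y + suc l) ≈ pow R ξ y
    same-root = R.trans (pow-+ ξ y (suc l)) (R.trans (R.*-cong R.refl ξ^ℓ≈1) (R.*-identityʳ _))

  rootSum-invariant : ∀ b λ′ → IsPartition λ′ → (∀ i → b ≤ i → row λ′ i ≡ 0) →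
    RibbonDecomp (suc l) λ′ → rootSum (betas b (row λ′)) ≈ rootSum (betas b (λ _ → 0))
  rootSum-invariant b λ′ partλ short (done empty) =
    R.reflexive (cong rootSum (betas-cong b _ _ (λ i _ → empty i)))
  rootSum-invariant b λ′ partλ short (remove ν partν ribbon D) =
    R.trans (rootSum-beadMove move drop) (rootSum-invariant b ν partν shortν D)
    where
    open RibbonMove (ribbonMove b (suc l) λ′ ν partλ partν short (s≤s z≤n) ribbon)
    shortν : ∀ i → b ≤ i → row ν i ≡ 0
    shortν i b≤i = n≤0⇒n≡0 (subst (row ν i ≤_) (short i b≤i) (proj₁ ribbon i))

  -- T n = ξⁿ + … + ξ¹, the root sum of β(∅) with n beads
  T : ℕ → Carrier
  T n = rootSum (betas n (λ _ → 0))

  rootSum-shift : ∀ n c → rootSum (betas n (λ _ → c)) ≈ pow R ξ c *ᵣ T n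
  rootSum-shift zero    c = R.sym (R.zeroʳ _)
  rootSum-shift (suc n) c = begin
    pow R ξ (c + suc n) +ᵣ rootSum (betas n (λ _ → c))   ≈⟨ R.+-cong (pow-+ ξ c (suc n)) (rootSum-shift n c) ⟩
    pow R ξ c *ᵣ pow R ξ (suc n) +ᵣ pow R ξ c *ᵣ T n     ≈⟨ R.sym (R.distribˡ _ _ _) ⟩
    pow R ξ c *ᵣ T (suc n)                              ∎

  T-geometric : ∀ n → ξ *ᵣ T n +ᵣ ξ ≈ T (suc n)
  T-geometric zero    = R.trans (R.+-cong (R.zeroʳ ξ) R.refl)
                          (R.trans (R.+-identityˡ ξ) (R.sym (R.trans (R.+-identityʳ _) (R.*-identityʳ ξ))))
  T-geometric (suc n) = begin
    ξ *ᵣ (pow R ξ (suc n) +ᵣ T n) +ᵣ ξ        ≈⟨ R.+-cong (R.distribˡ _ _ _) R.refl ⟩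
    (pow R ξ (suc (suc n)) +ᵣ ξ *ᵣ T n) +ᵣ ξ  ≈⟨ R.+-assoc _ _ _ ⟩
    pow R ξ (suc (suc n)) +ᵣ (ξ *ᵣ T n +ᵣ ξ)  ≈⟨ R.+-cong R.refl (T-geometric n) ⟩
    T (suc (suc n))                           ∎

module PrimitiveRoots (R : CommutativeRing 0ℓ 0ℓ) (domain : IsIntegralDomain R)
                      (ξ : CommutativeRing.Carrier R) (l : ℕ) (prim : IsPrimitiveRoot R (suc l) ξ) where
  module R = CommutativeRing R
  open R using (Carrier; _≈_; 0#; 1#; -_; setoid) renaming (_+_ to _+ᵣ_; _*_ to _*ᵣ_)
  open import Relation.Binary.Reasoning.Setoid setoid
  open Signs R using (pow-+; pow-multiple)
  open IntegralDomain R domain using (cancelʳ; square-root-of-one)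
  open RootSums R ξ l (proj₁ prim) using (rootSum; rootSum-invariant; T; rootSum-shift; T-geometric)

  ℓ : ℕ
  ℓ = suc l

  ξ≉0 : ¬ ξ ≈ 0#
  ξ≉0 ξ≈0 = proj₁ domain (begin
    1#               ≈⟨ R.sym (proj₁ prim) ⟩
    ξ *ᵣ pow R ξ l   ≈⟨ R.*-cong ξ≈0 R.refl ⟩
    0# *ᵣ pow R ξ l  ≈⟨ R.zeroˡ _ ⟩
    0#               ∎)

  pow≈1⇒∣ : ∀ n → pow R ξ n ≈ 1# → ℓ ∣ n
  pow≈1⇒∣ n ξⁿ≈1 = m%n≡0⇒n∣m n ℓ (residue-zero (n % ℓ) (m%n<n n ℓ) residue-one)
    where
    residue-one : pow R ξ (n % ℓ) ≈ 1#
    residue-one = begin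
      pow R ξ (n % ℓ)                                ≈⟨ R.sym (R.*-identityʳ _) ⟩
      pow R ξ (n % ℓ) *ᵣ 1#                          ≈⟨ R.*-cong R.refl (R.sym (pow-multiple ξ ℓ (proj₁ prim) (n / ℓ))) ⟩
      pow R ξ (n % ℓ) *ᵣ pow R ξ ((n / ℓ) * ℓ)       ≈⟨ R.sym (pow-+ ξ (n % ℓ) _) ⟩
      pow R ξ (n % ℓ + (n / ℓ) * ℓ)                  ≡⟨ cong (pow R ξ) (sym (m≡m%n+[m/n]*n n ℓ)) ⟩
      pow R ξ n                                      ≈⟨ ξⁿ≈1 ⟩
      1#                                             ∎
    residue-zero : ∀ ρ → ρ < ℓ → pow R ξ ρ ≈ 1# → ρ ≡ 0
    residue-zero zero    _   _   = refl
    residue-zero (suc ρ) ρ<ℓ one = ⊥-elim (proj₂ prim (suc ρ) (s≤s z≤n) ρ<ℓ one)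

  -- For ℓ = 2μ, ξ^μ is a square root of 1 different from 1, hence −1.
  half-power : ∀ μ → ℓ ≡ μ + μ → pow R ξ μ ≈ - 1#
  half-power μ ℓ≡2μ with square-root-of-one (pow R ξ μ) square
    where
    square : pow R ξ μ *ᵣ pow R ξ μ ≈ 1#
    square = R.trans (R.sym (pow-+ ξ μ μ)) (R.trans (R.reflexive (cong (pow R ξ) (sym ℓ≡2μ))) (proj₁ prim))
  ... | inj₂ ξ^μ≈-1 = ξ^μ≈-1
  ... | inj₁ ξ^μ≈1  = ⊥-elim (proj₂ prim μ 0<μ μ<ℓ ξ^μ≈1)
    where
    0<μ : 0 < μ
    0<μ = n≢0⇒n>0 (λ { refl → 0≢1+n (sym ℓ≡2μ) })
    μ<ℓ : μ < ℓ
    μ<ℓ = subst (μ <_) (sym ℓ≡2μ) (m<m+n μ 0<μ)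

  -- If a^b decomposes into ℓ-ribbons then ξᵃ·T b = T b, where
  -- T b = ξᵇ + … + ξ ≠ 0 unless ℓ ∣ b; hence ℓ ∣ a or ℓ ∣ b.
  rectangle-dichotomy : ∀ a b → RibbonDecomp ℓ (rect a b) → ℓ ∣ a ⊎ ℓ ∣ b
  rectangle-dichotomy a b D with cancelʳ (pow R ξ a) 1# (T b) invariant
    where
    invariant : pow R ξ a *ᵣ T b ≈ 1# *ᵣ T b
    invariant = begin
      pow R ξ a *ᵣ T b                    ≈⟨ R.sym (rootSum-shift b a) ⟩
      rootSum (betas b (λ _ → a))          ≡⟨ cong rootSum (betas-cong b _ _ (λ i i<b → sym (rect-row-< a b i i<b))) ⟩
      rootSum (betas b (row (rect a b)))   ≈⟨ rootSum-invariant b (rect a b) (rect-partition a b) (rect-row-≥ a b) D ⟩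
      T b                                  ≈⟨ R.sym (R.*-identityˡ _) ⟩
      1# *ᵣ T b                            ∎
  ... | inj₁ ξᵃ≈1  = inj₁ (pow≈1⇒∣ a ξᵃ≈1)
  ... | inj₂ Tb≈0 with cancelʳ (pow R ξ b) 1# ξ ξ-fixed
    where
    ξ-fixed : pow R ξ b *ᵣ ξ ≈ 1# *ᵣ ξ
    ξ-fixed = begin
      pow R ξ b *ᵣ ξ                ≈⟨ R.*-comm _ _ ⟩
      pow R ξ (suc b)               ≈⟨ R.sym (R.+-identityʳ _) ⟩
      pow R ξ (suc b) +ᵣ 0#         ≈⟨ R.+-cong R.refl (R.sym Tb≈0) ⟩
      T (suc b)                     ≈⟨ R.sym (T-geometric b) ⟩
      ξ *ᵣ T b +ᵣ ξ                 ≈⟨ R.+-cong (R.trans (R.*-cong R.refl Tb≈0) (R.zeroʳ ξ)) R.refl ⟩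
      0# +ᵣ ξ                       ≈⟨ R.+-identityˡ ξ ⟩
      ξ                             ≈⟨ R.sym (R.*-identityˡ ξ) ⟩
      1# *ᵣ ξ                       ∎
  ...   | inj₁ ξᵇ≈1 = inj₂ (pow≈1⇒∣ b ξᵇ≈1)
  ...   | inj₂ ξ≈0  = ⊥-elim (ξ≉0 ξ≈0)

exponentFor : Parity → ℕ → ℕ → ℕ
exponentFor 0ℙ a b = b * ⌊ a * b /2⌋
exponentFor 1ℙ a b = a * b

exponent : ℕ → ℕ → ℕ
exponent a b = exponentFor (parity (a * b)) a b

even⇒double : ∀ n → parity n ≡ 0ℙ → n ≡ ⌊ n /2⌋ + ⌊ n /2⌋
even⇒double zero          _    = refl
even⇒double (suc (suc n)) even =
  cong suc (trans (cong suc (even⇒double n even)) (sym (+-suc ⌊ n /2⌋ ⌊ n /2⌋)))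

exponent-pos : ∀ a b → 0 < a → 0 < b → 0 < exponent a b
exponent-pos a b 0<a 0<b = by (parity (a * b)) refl
  where
  0<ab : 0 < a * b
  0<ab = *-mono-≤ 0<a 0<b
  by : ∀ p → parity (a * b) ≡ p → 0 < exponentFor p a b
  by 1ℙ _    = 0<ab
  by 0ℙ even = *-mono-≤ 0<b (n≢0⇒n>0 half≢0)
    where
    half≢0 : ¬ ⌊ a * b /2⌋ ≡ 0
    half≢0 half≡0 = <-irrefl (sym (trans (even⇒double (a * b) even) (cong (λ h → h + h) half≡0))) 0<ab

module ExponentArithmetic (a b q l : ℕ) (ab≡qℓ : a * b ≡ q * suc l) where
  open ≡-Reasoning

  ℓ : ℕ
  ℓ = suc l

  -- ℓ odd: E is a multiple of ℓ (for ab even, q is even and E = b·(q/2)·ℓ).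
  odd-ℓ-divides : parity l ≡ 0ℙ → ℓ ∣ exponent a b
  odd-ℓ-divides l-even = by (parity (a * b)) refl
    where
    by : ∀ p → parity (a * b) ≡ p → ℓ ∣ exponentFor p a b
    by 1ℙ _       = divides q ab≡qℓ
    by 0ℙ ab-even = divides (b * h) (begin
      b * ⌊ a * b /2⌋            ≡⟨ cong (λ n → b * ⌊ n /2⌋) ab≡2hℓ ⟩
      b * ⌊ h * ℓ + h * ℓ /2⌋     ≡⟨ cong (b *_) (sym (n≡⌊n+n/2⌋ (h * ℓ))) ⟩
      b * (h * ℓ)                ≡⟨ sym (*-assoc b h ℓ) ⟩
      b * h * ℓ                  ∎)
      where
      q-even : parity q ≡ 0ℙ
      q-even = begin
        parity q                   ≡⟨ sym (ℙ.*-identityʳ (parity q)) ⟩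
        parity q ℙ.* 1ℙ            ≡⟨ cong (λ p → parity q ℙ.* p ℙ.⁻¹) (sym l-even) ⟩
        parity q ℙ.* parity l ℙ.⁻¹ ≡⟨ cong (parity q ℙ.*_) (sym (parity-suc l)) ⟩
        parity q ℙ.* parity ℓ      ≡⟨ sym (ℙ.*-homo-* q ℓ) ⟩
        parity (q * ℓ)             ≡⟨ cong parity (sym ab≡qℓ) ⟩
        parity (a * b)             ≡⟨ ab-even ⟩
        0ℙ                         ∎
      h : ℕ
      h = ⌊ q /2⌋
      ab≡2hℓ : a * b ≡ h * ℓ + h * ℓ
      ab≡2hℓ = trans ab≡qℓ (trans (cong (_* ℓ) (even⇒double q q-even)) (*-distribʳ-+ ℓ h h))

  -- ℓ = 2μ even: ab = 2qμ is even and E = b·qμ.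
  even-ℓ-exponent : ∀ μ → ℓ ≡ μ + μ → exponent a b ≡ μ * (b * q)
  even-ℓ-exponent μ ℓ≡2μ = begin
    exponentFor (parity (a * b)) a b ≡⟨ cong (λ p → exponentFor p a b) ab-even ⟩
    b * ⌊ a * b /2⌋                  ≡⟨ cong (λ n → b * ⌊ n /2⌋) ab≡2qμ ⟩
    b * ⌊ q * μ + q * μ /2⌋           ≡⟨ cong (b *_) (sym (n≡⌊n+n/2⌋ (q * μ))) ⟩
    b * (q * μ)                      ≡⟨ solve 3 (λ b q μ → b :* (q :* μ) := μ :* (b :* q)) refl b q μ ⟩
    μ * (b * q)                      ∎
    where
    ab≡2qμ : a * b ≡ q * μ + q * μ
    ab≡2qμ = trans ab≡qℓ (trans (cong (q *_) ℓ≡2μ) (*-distribˡ-+ q μ μ))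
    ab-even : parity (a * b) ≡ 0ℙ
    ab-even = trans (cong parity ab≡2qμ) (parity-+-double 0 (q * μ))

  even-ℓ : parity l ≡ 1ℙ → ℓ ≡ ⌊ ℓ /2⌋ + ⌊ ℓ /2⌋
  even-ℓ l-odd = even⇒double ℓ (trans (parity-suc l) (cong ℙ._⁻¹ l-odd))

  even-ℓ-∣b : parity l ≡ 1ℙ → ℓ ∣ b → parity (b * q) ≡ 0ℙ
  even-ℓ-∣b l-odd (divides c b≡cℓ) = begin
    parity (b * q)             ≡⟨ ℙ.*-homo-* b q ⟩
    parity b ℙ.* parity q      ≡⟨ cong (λ n → parity n ℙ.* parity q) b≡2cμ ⟩
    parity (c * μ + c * μ) ℙ.* parity q ≡⟨ cong (ℙ._* parity q) (parity-+-double 0 (c * μ)) ⟩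
    0ℙ                         ∎
    where
    μ : ℕ
    μ = ⌊ ℓ /2⌋
    b≡2cμ : b ≡ c * μ + c * μ
    b≡2cμ = trans b≡cℓ (trans (cong (c *_) (even-ℓ l-odd)) (*-distribˡ-+ c μ μ))

  -- ℓ even and ℓ ∣ a: q = (a/ℓ)·b, so bq and q(ℓ − 1) have the same parity.
  even-ℓ-∣a : parity l ≡ 1ℙ → ℓ ∣ a → parity (b * q) ≡ parity (q * l)
  even-ℓ-∣a l-odd (divides α a≡αℓ) = begin
    parity (b * q)                              ≡⟨ ℙ.*-homo-* b q ⟩
    parity b ℙ.* parity q                       ≡⟨ cong (λ n → parity b ℙ.* parity n) q≡αb ⟩
    parity b ℙ.* parity (α * b)                 ≡⟨ cong (parity b ℙ.*_) (ℙ.*-homo-* α b) ⟩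
    parity b ℙ.* (parity α ℙ.* parity b)        ≡⟨ absorb (parity b) (parity α) ⟩
    parity α ℙ.* parity b                       ≡⟨ sym (ℙ.*-homo-* α b) ⟩
    parity (α * b)                              ≡⟨ cong parity (sym q≡αb) ⟩
    parity q                                    ≡⟨ sym (ℙ.*-identityʳ (parity q)) ⟩
    parity q ℙ.* 1ℙ                             ≡⟨ cong (parity q ℙ.*_) (sym l-odd) ⟩
    parity q ℙ.* parity l                       ≡⟨ sym (ℙ.*-homo-* q l) ⟩
    parity (q * l)                              ∎
    where
    q≡αb : q ≡ α * b
    q≡αb = *-cancelʳ-≡ q (α * b) ℓ (trans (sym ab≡qℓ) (trans (cong (_* b) a≡αℓ)
             (solve 3 (λ α ℓ b → α :* ℓ :* b := α :* b :* ℓ) refl α ℓ b)))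
    absorb : ∀ x y → x ℙ.* (y ℙ.* x) ≡ y ℙ.* x
    absorb 0ℙ 0ℙ = refl
    absorb 0ℙ 1ℙ = refl
    absorb 1ℙ y  = refl

  odd-ℓ-legs : parity l ≡ 0ℙ → parity (q * l) ≡ 0ℙ
  odd-ℓ-legs l-even = trans (ℙ.*-homo-* q l) (trans (cong (parity q ℙ.*_) l-even) (ℙ.*-zeroʳ (parity q)))

module ExponentValue (R : CommutativeRing 0ℓ 0ℓ) (domain : IsIntegralDomain R)
                     (ξ : CommutativeRing.Carrier R) (l : ℕ) (prim : IsPrimitiveRoot R (suc l) ξ)
                     (a b q : ℕ) (ab≡qℓ : a * b ≡ q * suc l) where
  module R = CommutativeRing R
  open R using (_≈_; 1#; setoid)
  open import Relation.Binary.Reasoning.Setoid setoid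
  open Signs R using (pow-*; pow-congˡ; pow-multiple; negOnePow-parity)
  open PrimitiveRoots R domain ξ l prim using (half-power)
  open ExponentArithmetic a b q l ab≡qℓ

  odd-ℓ-power : parity l ≡ 0ℙ → pow R ξ (exponent a b) ≈ 1#
  odd-ℓ-power l-even with odd-ℓ-divides l-even
  ... | divides k E≡kℓ = R.trans (R.reflexive (cong (pow R ξ) E≡kℓ)) (pow-multiple ξ ℓ (proj₁ prim) k)

  -- ℓ = 2μ even: ξ^E = (ξ^μ)^{bq} = (−1)^{bq}.
  even-ℓ-power : parity l ≡ 1ℙ → pow R ξ (exponent a b) ≈ negOnePow R (b * q)
  even-ℓ-power l-odd = begin
    pow R ξ (exponent a b)        ≡⟨ cong (pow R ξ) (even-ℓ-exponent μ (even-ℓ l-odd)) ⟩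
    pow R ξ (μ * (b * q))         ≈⟨ pow-* ξ μ (b * q) ⟩
    pow R (pow R ξ μ) (b * q)     ≈⟨ pow-congˡ (b * q) (half-power μ (even-ℓ l-odd)) ⟩
    negOnePow R (b * q)           ∎
    where
    μ : ℕ
    μ = ⌊ ℓ /2⌋

  power-when-∣b : ℓ ∣ b → pow R ξ (exponent a b) ≈ 1#
  power-when-∣b ℓ∣b with parity l in l-parity
  ... | 0ℙ = odd-ℓ-power l-parity
  ... | 1ℙ = R.trans (even-ℓ-power l-parity) (negOnePow-parity (b * q) 0 (even-ℓ-∣b l-parity ℓ∣b))

  power-when-∣a : ℓ ∣ a → pow R ξ (exponent a b) ≈ negOnePow R (q * l)
  power-when-∣a ℓ∣a with parity l in l-parity
  ... | 0ℙ = R.trans (odd-ℓ-power l-parity) (negOnePow-parity 0 (q * l) (sym (odd-ℓ-legs l-parity)))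
  ... | 1ℙ = R.trans (even-ℓ-power l-parity) (negOnePow-parity (b * q) (q * l) (even-ℓ-∣a l-parity ℓ∣a))

module RectangleSign (R : CommutativeRing 0ℓ 0ℓ) (domain : IsIntegralDomain R)
                     (ξ : CommutativeRing.Carrier R) (l : ℕ) (prim : IsPrimitiveRoot R (suc l) ξ)
                     (a b q : ℕ) (ab≡qℓ : a * b ≡ q * suc l) (D : RibbonDecomp (suc l) (rect a b)) where
  module R = CommutativeRing R
  open R using (_≈_; 1#; setoid) renaming (_*_ to _*ᵣ_)
  open import Relation.Binary.Reasoning.Setoid setoid
  open Signs R using (decompSign≈legLength; negOnePow-parity; negOnePow-+)
  open PrimitiveRoots R domain ξ l prim using (rectangle-dichotomy)
  open ExponentValue R domain ξ l prim a b q ab≡qℓ using (power-when-∣a; power-when-∣b)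

  sign : negOnePow R (q * l) *ᵣ decompSign R D ≈ pow R ξ (exponent a b)
  sign with rectangle-dichotomy a b D
  ... | inj₁ ℓ∣a = begin
    negOnePow R (q * l) *ᵣ decompSign R D
      ≈⟨ R.*-cong R.refl (decompSign≈legLength D) ⟩
    negOnePow R (q * l) *ᵣ negOnePow R (legLength D)
      ≈⟨ R.*-cong R.refl (negOnePow-parity (legLength D) 0 (rectangle-legs-∣a a b l ℓ∣a D)) ⟩
    negOnePow R (q * l) *ᵣ 1#
      ≈⟨ R.*-identityʳ _ ⟩
    negOnePow R (q * l)
      ≈⟨ R.sym (power-when-∣a ℓ∣a) ⟩
    pow R ξ (exponent a b) ∎
  ... | inj₂ ℓ∣b = begin
    negOnePow R (q * l) *ᵣ decompSign R D
      ≈⟨ R.*-cong R.refl (decompSign≈legLength D) ⟩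
    negOnePow R (q * l) *ᵣ negOnePow R (legLength D)
      ≈⟨ R.*-cong R.refl (negOnePow-parity (legLength D) (q * l) (rectangle-legs-∣b a b l q ℓ∣b ab≡qℓ D)) ⟩
    negOnePow R (q * l) *ᵣ negOnePow R (q * l)
      ≈⟨ R.sym (negOnePow-+ (q * l) (q * l)) ⟩
    negOnePow R (q * l + q * l)
      ≈⟨ negOnePow-parity (q * l + q * l) 0 (parity-+-double 0 (q * l)) ⟩
    1#
      ≈⟨ R.sym (power-when-∣b ℓ∣b) ⟩
    pow R ξ (exponent a b) ∎

-- E = exponent a b works for every ℓ; the hypothesis ℓ ∣ M only serves to
-- exclude ℓ = 0.
mainTheorem13 : (a b M : ℕ) → 0 < a → 0 < b → 0 < M → M ∣ a * b →
    ∃[ E ] (0 < E × (∀ (ℓ : ℕ) → ℓ ∣ M → (D : RibbonDecomp ℓ (rect a b)) →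
      (q : ℕ) → a * b ≡ q * ℓ →
      (R : CommutativeRing 0ℓ 0ℓ) → IsIntegralDomain R →
      (ξ : CommutativeRing.Carrier R) → IsPrimitiveRoot R ℓ ξ →
      CommutativeRing._≈_ R
        (CommutativeRing._*_ R (negOnePow R (q * (ℓ ∸ 1))) (decompSign R D))
        (pow R ξ E)))
mainTheorem13 a b M 0<a 0<b 0<M _ = exponent a b , exponent-pos a b 0<a 0<b , sign-identity
  where
  sign-identity : ∀ ℓ → ℓ ∣ M → (D : RibbonDecomp ℓ (rect a b)) → (q : ℕ) → a * b ≡ q * ℓ →
    (R : CommutativeRing 0ℓ 0ℓ) → IsIntegralDomain R →
    (ξ : CommutativeRing.Carrier R) → IsPrimitiveRoot R ℓ ξ →
    CommutativeRing._≈_ R (CommutativeRing._*_ R (negOnePow R (q * (ℓ ∸ 1))) (decompSign R D))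
                          (pow R ξ (exponent a b))
  sign-identity zero    0∣M = ⊥-elim (<-irrefl (sym (0∣⇒≡0 0∣M)) 0<M)
  sign-identity (suc l) _   D q ab≡qℓ R domain ξ prim = RectangleSign.sign R domain ξ l prim a b q ab≡qℓ D
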